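{- Let $G$ be a graph in which every internal vertex is of type $0$ or type $1$, and let $n_0$ be the maximum number of vertices of a connected component of $G_0$ (with $n_0=0$ if $G_0$ is null). Then: (1) $G$ is well-covered if and only if $G_0$ is well-covered and for every independent set $I$ in $G_1$ with $|I|\leq n_0$ we have $i(G_0-N(I))=\alpha(G_0)$; (2) $\mu_\alpha(G)\leq 1$ if and only if $\mu_\alpha(G_0)\leq 1$ and for every independent set $I$ in $G_1$ with $|I|\leq 2n_0$ we have $\alpha(G_0)-i(G_0-N(I))\leq 1$.
   Context: All graphs are finite and simple; the null graph (no vertices) is allowed, with $\alpha=i=0$. For a graph $G$, $\alpha(G)$ is the maximum size of an independent set, $i(G)$ is the minimum size of an inclusion-maximal independent set, $\mu_\alpha(G)=\alpha(G)-i(G)$, and $G$ is well-covered if $\mu_\alpha(G)=0$. $N(I)$ is the open neighborhood in $G$ and $G_0-N(I)$ is obtained from $G_0$ by deleting the vertices of $N(I)$. Types: let $U$ be the set of vertices whose connected component in $G$ is a complete graph. In $G-U$, a leaf is a vertex of degree $1$ and an internal vertex is a vertex that is not a leaf. An internal vertex of $G-U$ adjacent to exactly $k$ leaves is of type $k$; every vertex of $U$ is of type $0$. $G_i$ denotes the subgraph of $G$ induced by all vertices of type $i$. -}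

module Defs where

open import Data.Bool using (Bool; true; false; _∧_; _∨_; not)
open import Data.Nat using (ℕ; zero; suc; _⊔_; _⊓_; _∸_; _≤_)
open import Data.Fin using (Fin)
open import Data.Vec using (Vec; []; _∷_; lookup; tabulate)
open import Data.List using (List; map; _++_; foldr; filterᵇ; allFin)
open import Data.Bool.ListAction using (all; any)
import Data.List as L
open import Data.Fin.Subset using (Subset; inside; outside; ∣_∣; _∈_; _⊆_; _∩_; ∁; ⊤)
open import Data.Product using (Σ; _×_; _,_)
open import Data.Sum using (_⊎_)
open import Relation.Nullary using (¬_)
open import Relation.Binary.PropositionalEquality using (_≡_; _≢_)
open import Function.Bundles using (_⇔_)

record Graph (n : ℕ) : Set where
  field
    adj    : Fin n → Fin n → Bool
    sym    : ∀ u v → adj u v ≡ adj v u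
    irrefl : ∀ v → adj v v ≡ false
open Graph public

module _ {n : ℕ} (G : Graph n) where

  Edge : Fin n → Fin n → Set
  Edge u v = adj G u v ≡ true

  Independent : Subset n → Set
  Independent T = ∀ u v → u ∈ T → v ∈ T → ¬ Edge u v

  independentᵇ : Subset n → Bool
  independentᵇ T = all (λ u → all (λ v → not (lookup T u ∧ lookup T v ∧ adj G u v)) (allFin n)) (allFin n)

  subsetᵇ : Subset n → Subset n → Bool
  subsetᵇ T S = all (λ v → not (lookup T v) ∨ lookup S v) (allFin n)

  maximalIndepInᵇ : Subset n → Subset n → Bool
  maximalIndepInᵇ S T =
    subsetᵇ T S ∧ independentᵇ T ∧
    all (λ v → not (lookup S v) ∨ lookup T v ∨ any (λ u → lookup T u ∧ adj G u v) (allFin n)) (allFin n)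

allSubsets : (n : ℕ) → List (Subset n)
allSubsets zero = [] L.∷ L.[]
allSubsets (suc n) = map (outside ∷_) (allSubsets n) ++ map (inside ∷_) (allSubsets n)

module _ {n : ℕ} (G : Graph n) where

  α : Subset n → ℕ
  α S = foldr _⊔_ 0 (map ∣_∣ (filterᵇ (λ T → subsetᵇ G T S ∧ independentᵇ G T) (allSubsets n)))

  -- i(G[S]) : minimum size of an inclusion-maximal independent set of G[S]
  -- (n is an upper bound for all candidates, and a maximal one always exists)
  iNum : Subset n → ℕ
  iNum S = foldr _⊓_ n (map ∣_∣ (filterᵇ (maximalIndepInᵇ G S) (allSubsets n)))

  μα : Subset n → ℕ
  μα S = α S ∸ iNum S

  WellCovered : Subset n → Set
  WellCovered S = μα S ≡ 0

  N : Subset n → Subset n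
  N I = tabulate (λ v → any (λ u → lookup I u ∧ adj G u v) (allFin n))

  data Reach : Fin n → Fin n → Set where
    here : ∀ {u} → Reach u u
    step : ∀ {u v w} → Edge G u v → Reach v w → Reach u w

  data ReachIn (S : Subset n) : Fin n → Fin n → Set where
    here : ∀ {u} → u ∈ S → ReachIn S u u
    step : ∀ {u v w} → u ∈ S → Edge G u v → ReachIn S v w → ReachIn S u w

  InU : Fin n → Set
  InU v = ∀ u w → Reach v u → Reach v w → u ≢ w → Edge G u w

  Leaf : Fin n → Set
  Leaf v = ¬ InU v × Σ (Fin n) (λ u → Edge G v u × ¬ InU u × (∀ w → Edge G v w → ¬ InU w → w ≡ u))

  Internal : Fin n → Set
  Internal v = ¬ InU v × ¬ Leaf v

  LeafNbrCount : Fin n → ℕ → Set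
  LeafNbrCount v k = Σ (Subset n) (λ L → (∀ w → (w ∈ L) ⇔ (Edge G v w × Leaf w)) × ∣ L ∣ ≡ k)

  HasType : ℕ → Fin n → Set
  HasType k v = (InU v × k ≡ 0) ⊎ (Internal v × LeafNbrCount v k)

  CompSize : Subset n → Fin n → ℕ → Set
  CompSize S v k = Σ (Subset n) (λ C → (∀ u → (u ∈ C) ⇔ ReachIn S v u) × ∣ C ∣ ≡ k)

  IsMaxCompSize : Subset n → ℕ → Set
  IsMaxCompSize S m =
    (∀ v k → v ∈ S → CompSize S v k → k ≤ m) ×
    (m ≡ 0 ⊎ Σ (Fin n) (λ v → v ∈ S × CompSize S v m))

-- Let L be the set of leaves of G − U. Every maximal independent set M of G splits as
-- I ∪ J ∪ (L − N(I)) with I = M ∩ V(G₁) independent and J maximal independent in G₀ − N(I), and every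
-- such pair (I, J) arises; as each type-1 vertex has exactly one leaf and each leaf exactly one
-- neighbour, ∣M∣ = ∣L∣ + ∣J∣. Hence α(G) = ∣L∣ + α(G₀) and i(G) = ∣L∣ + min_I i(G₀ − N(I)), so
-- α(G) − i(G) ≤ e iff α(G₀) − i(G₀ − N(I)) ≤ e for all independent I ⊆ V(G₁).
-- To restrict to small I, fix such I and J and a union D of components of G₀. Choosing one
-- neighbour in I for each vertex of D ∩ N(I) gives I′ ⊆ I with ∣I′∣ ≤ ∣D∣ and N(I′) ∩ D = N(I) ∩ D,
-- so the hypothesis for I′ yields α(D) ≤ ∣J ∩ D∣ + e. For e = 0 apply this to every component and
-- sum. For e = 1 at most one component C has α(C) > ∣J ∩ C∣, since two of them would form a D with
-- ∣D∣ ≤ 2n₀ and α(D) ≥ ∣J ∩ D∣ + 2.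

module Submission where

open import Defs hiding (sym)
open import Data.Bool using (Bool; true; false; T; not; _∧_; _∨_)
open import Data.Bool.Properties using (T-≡; T-∧; T-∨)
open import Data.Bool.ListAction using (all; any)
open import Data.Nat using (ℕ; zero; suc; _+_; _*_; _∸_; _≤_; _<_; _>_; _<?_; _⊔_; _⊓_; z≤n; s≤s)
open import Data.Nat.Properties hiding (_≟_)
open import Data.Fin using (Fin)
open import Data.Fin.Subset
  using (Subset; inside; outside; ∣_∣; _∈_; _∉_; _⊆_; _∩_; _∪_; ∁; ⊤; ⁅_⁆; Nonempty)
  renaming (⊥ to ∅)
open import Data.Fin.Subset.Properties
open import Data.List using (allFin; filterᵇ)
open import Data.List.Membership.Propositional using (lose) renaming (_∈_ to _∈ˡ_)
open import Data.List.Membership.Propositional.Properties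
  using (∈-allFin; ∈-++⁺ˡ; ∈-++⁺ʳ; ∈-map⁺; ∈-filter⁺; ∈-map∘filter⁻; foldr-selective)
open import Data.List.Properties using (foldr-preservesᵒ)
open import Data.List.Relation.Unary.Any as Any using (satisfied)
open import Data.List.Relation.Unary.All as All using ()
open import Data.List.Relation.Unary.All.Properties using (all⁺; all⁻)
open import Data.List.Relation.Unary.Any.Properties using (any⁺; any⁻)
open import Data.Vec using (Vec; _∷_; lookup; tabulate)
open import Data.Vec.Properties using ([]=⇒lookup; lookup⇒[]=; lookup∘tabulate; ≡-dec)
open import Data.Product using (∃; _×_; _,_; proj₁; proj₂)
open import Data.Sum using (_⊎_; inj₁; inj₂; [_,_]′)
open import Relation.Nullary using (¬_; Dec; yes; no; contradiction)
open import Relation.Unary using (Decidable)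
open import Relation.Nullary.Decidable using (isYes; toWitness; fromWitness; T?; ¬?; _×-dec_; decidable-stable)
open import Data.Fin.Properties using (any?; _≟_)
open import Relation.Binary.PropositionalEquality hiding (J)
open import Function using (_∘_)
open import Algebra.Properties.CommutativeSemigroup +-commutativeSemigroup using (x∙yz≈xz∙y; xy∙z≈xz∙y)
open import Function.Bundles using (_⇔_; mk⇔; Equivalence)

private
  variable
    n : ℕ

open Equivalence using (to; from)

∈⇔T-lookup : ∀ {x : Fin n} {p : Subset n} → x ∈ p ⇔ T (lookup p x)
∈⇔T-lookup {x = x} {p} =
  mk⇔ (λ x∈p → from T-≡ ([]=⇒lookup x∈p)) (λ t → lookup⇒[]= x p (to T-≡ t))

T-not-∨⇔→ : ∀ {a b} → T (not a ∨ b) ⇔ (T a → T b)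
T-not-∨⇔→ {true}  = mk⇔ (λ t _ → t) (λ f → f _)
T-not-∨⇔→ {false} = mk⇔ (λ _ ()) (λ _ → _)

T-not⇔¬T : ∀ {b} → T (not b) ⇔ (¬ T b)
T-not⇔¬T {true}  = mk⇔ (λ ()) (λ ¬t → ¬t _)
T-not⇔¬T {false} = mk⇔ (λ _ ()) (λ _ → _)

T-all-allFin : (f : Fin n → Bool) → T (all f (allFin n)) ⇔ (∀ x → T (f x))
T-all-allFin f =
  mk⇔ (λ t x → All.lookup (all⁺ f (allFin _) t) (∈-allFin x))
      (λ h → all⁻ f {xs = allFin _} (All.tabulate (λ {x} _ → h x)))

T-any-allFin : (f : Fin n → Bool) → T (any f (allFin n)) ⇔ ∃ (T ∘ f)
T-any-allFin f = mk⇔ (satisfied ∘ any⁻ f (allFin _)) (λ (x , t) → any⁺ f (lose (∈-allFin x) t))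

m∸n≤o⇔m≤n+o : ∀ {m n o} → m ∸ n ≤ o ⇔ m ≤ n + o
m∸n≤o⇔m≤n+o {m} {n} = mk⇔ (λ m∸n≤o → ≤-trans (m≤n+m∸n m n) (+-monoʳ-≤ n m∸n≤o)) (m≤n+o⇒m∸n≤o m n)

∣p∣≡∣p∩q∣+∣p∩∁q∣ : (p q : Subset n) → ∣ p ∣ ≡ ∣ p ∩ q ∣ + ∣ p ∩ ∁ q ∣
∣p∣≡∣p∩q∣+∣p∩∁q∣ Vec.[] Vec.[] = refl
∣p∣≡∣p∩q∣+∣p∩∁q∣ (inside ∷ p)  (inside ∷ q)  = cong suc (∣p∣≡∣p∩q∣+∣p∩∁q∣ p q)
∣p∣≡∣p∩q∣+∣p∩∁q∣ (inside ∷ p)  (outside ∷ q) = trans (cong suc (∣p∣≡∣p∩q∣+∣p∩∁q∣ p q)) (sym (+-suc _ _))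
∣p∣≡∣p∩q∣+∣p∩∁q∣ (outside ∷ p) (inside ∷ q)  = ∣p∣≡∣p∩q∣+∣p∩∁q∣ p q
∣p∣≡∣p∩q∣+∣p∩∁q∣ (outside ∷ p) (outside ∷ q) = ∣p∣≡∣p∩q∣+∣p∩∁q∣ p q

[p∪q]∩∁p⊆q : (p q : Subset n) → (p ∪ q) ∩ ∁ p ⊆ q
[p∪q]∩∁p⊆q p q x∈ = let x∈p∪q , x∈∁p = x∈p∩q⁻ (p ∪ q) (∁ p) x∈ in
  [ contradiction x∈∁p ∘ x∈p⇒x∉∁p , (λ x∈q → x∈q) ]′ (x∈p∪q⁻ p q x∈p∪q)

∣p∪q∣≤∣p∣+∣q∣ : (p q : Subset n) → ∣ p ∪ q ∣ ≤ ∣ p ∣ + ∣ q ∣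
∣p∪q∣≤∣p∣+∣q∣ p q = begin
  ∣ p ∪ q ∣                           ≡⟨ ∣p∣≡∣p∩q∣+∣p∩∁q∣ (p ∪ q) p ⟩
  ∣ (p ∪ q) ∩ p ∣ + ∣ (p ∪ q) ∩ ∁ p ∣ ≤⟨ +-mono-≤ (∣p∩q∣≤∣q∣ (p ∪ q) p) (p⊆q⇒∣p∣≤∣q∣ ([p∪q]∩∁p⊆q p q)) ⟩
  ∣ p ∣ + ∣ q ∣                       ∎
  where open ≤-Reasoning

disjoint⇒[p∪q]∩∁p≡q : (p q : Subset n) → (∀ {x} → x ∈ p → x ∉ q) → (p ∪ q) ∩ ∁ p ≡ q
disjoint⇒[p∪q]∩∁p≡q p q disjoint = ⊆-antisym ([p∪q]∩∁p⊆q p q)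
  (λ x∈q → x∈p∩q⁺ (q⊆p∪q p q x∈q , x∉p⇒x∈∁p (λ x∈p → disjoint x∈p x∈q)))

disjoint⇒∣p∪q∣≡∣p∣+∣q∣ : (p q : Subset n) → (∀ {x} → x ∈ p → x ∉ q) → ∣ p ∪ q ∣ ≡ ∣ p ∣ + ∣ q ∣
disjoint⇒∣p∪q∣≡∣p∣+∣q∣ p q disjoint = begin
  ∣ p ∪ q ∣                           ≡⟨ ∣p∣≡∣p∩q∣+∣p∩∁q∣ (p ∪ q) p ⟩
  ∣ (p ∪ q) ∩ p ∣ + ∣ (p ∪ q) ∩ ∁ p ∣ ≡⟨ cong₂ (λ a b → ∣ a ∣ + ∣ b ∣) [p∪q]∩p≡p (disjoint⇒[p∪q]∩∁p≡q p q disjoint) ⟩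
  ∣ p ∣ + ∣ q ∣                       ∎
  where
  open ≡-Reasoning
  [p∪q]∩p≡p : (p ∪ q) ∩ p ≡ p
  [p∪q]∩p≡p = ⊆-antisym (p∩q⊆q (p ∪ q) p) (λ x∈p → x∈p∩q⁺ (p⊆p∪q q x∈p , x∈p))

x∈p⇒∣p∣≡1+∣p∩∁⁅x⁆∣ : ∀ {x} {p : Subset n} → x ∈ p → ∣ p ∣ ≡ suc ∣ p ∩ ∁ ⁅ x ⁆ ∣
x∈p⇒∣p∣≡1+∣p∩∁⁅x⁆∣ {x = x} {p} x∈p = begin
  ∣ p ∣                               ≡⟨ ∣p∣≡∣p∩q∣+∣p∩∁q∣ p ⁅ x ⁆ ⟩
  ∣ p ∩ ⁅ x ⁆ ∣ + ∣ p ∩ ∁ ⁅ x ⁆ ∣     ≡⟨ cong (λ a → ∣ a ∣ + ∣ p ∩ ∁ ⁅ x ⁆ ∣) p∩⁅x⁆≡⁅x⁆ ⟩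
  ∣ ⁅ x ⁆ ∣ + ∣ p ∩ ∁ ⁅ x ⁆ ∣         ≡⟨ cong (_+ ∣ p ∩ ∁ ⁅ x ⁆ ∣) (∣⁅x⁆∣≡1 x) ⟩
  suc ∣ p ∩ ∁ ⁅ x ⁆ ∣                 ∎
  where
  open ≡-Reasoning
  p∩⁅x⁆≡⁅x⁆ : p ∩ ⁅ x ⁆ ≡ ⁅ x ⁆
  p∩⁅x⁆≡⁅x⁆ = ⊆-antisym (p∩q⊆q p ⁅ x ⁆)
    (λ y∈⁅x⁆ → x∈p∩q⁺ (subst (_∈ p) (sym (x∈⁅y⁆⇒x≡y x y∈⁅x⁆)) x∈p , y∈⁅x⁆))

x∈p⇒∣p∣>0 : ∀ {x} {p : Subset n} → x ∈ p → ∣ p ∣ > 0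
x∈p⇒∣p∣>0 x∈p = ≤-trans (s≤s z≤n) (≤-reflexive (sym (x∈p⇒∣p∣≡1+∣p∩∁⁅x⁆∣ x∈p)))

∣p∣≢0⇒Nonempty : ∀ {n} (p : Subset n) → ∣ p ∣ ≢ 0 → Nonempty p
∣p∣≢0⇒Nonempty {n} p ∣p∣≢0 with nonempty? p
... | yes ne = ne
... | no ¬ne = contradiction (trans (cong ∣_∣ (Empty-unique ¬ne)) (∣⊥∣≡0 n)) ∣p∣≢0

∣p∣≡1⇒x≡y : ∀ {p : Subset n} {x y} → ∣ p ∣ ≡ 1 → x ∈ p → y ∈ p → x ≡ y
∣p∣≡1⇒x≡y {p = p} {x} {y} ∣p∣≡1 x∈p y∈p = decidable-stable (x ≟ y) λ x≢y →
  let y∈p-x = x∈p∩q⁺ (y∈p , x∉p⇒x∈∁p (x≢y ∘ sym ∘ x∈⁅y⁆⇒x≡y x)) in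
  1+n≢0 (trans (sym (x∈p⇒∣p∣≡1+∣p∩∁⁅x⁆∣ y∈p-x)) (suc-injective (trans (sym (x∈p⇒∣p∣≡1+∣p∩∁⁅x⁆∣ x∈p)) ∣p∣≡1)))

injection⇒∣p∣≤∣q∣ : ∀ {m} (p : Subset n) (q : Subset m) (f : Fin n → Fin m) →
  (∀ {x} → x ∈ p → f x ∈ q) → (∀ {x y} → x ∈ p → y ∈ p → f x ≡ f y → x ≡ y) → ∣ p ∣ ≤ ∣ q ∣
injection⇒∣p∣≤∣q∣ p q f into injective = go ∣ p ∣ p q refl into injective
  where
  go : ∀ k p q → ∣ p ∣ ≡ k → (∀ {x} → x ∈ p → f x ∈ q) →
       (∀ {x y} → x ∈ p → y ∈ p → f x ≡ f y → x ≡ y) → ∣ p ∣ ≤ ∣ q ∣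
  go zero    p q ∣p∣≡0 _ _ = ≤-trans (≤-reflexive ∣p∣≡0) z≤n
  go (suc k) p q ∣p∣≡1+k into injective with ∣p∣≢0⇒Nonempty p (λ ∣p∣≡0 → 1+n≢0 (trans (sym ∣p∣≡1+k) ∣p∣≡0))
  ... | a , a∈p = begin
    ∣ p ∣                     ≡⟨ x∈p⇒∣p∣≡1+∣p∩∁⁅x⁆∣ a∈p ⟩
    suc ∣ p ∩ ∁ ⁅ a ⁆ ∣       ≤⟨ s≤s (go k (p ∩ ∁ ⁅ a ⁆) (q ∩ ∁ ⁅ f a ⁆) ∣p-a∣≡k into′ injective′) ⟩
    suc ∣ q ∩ ∁ ⁅ f a ⁆ ∣     ≡⟨ x∈p⇒∣p∣≡1+∣p∩∁⁅x⁆∣ (into a∈p) ⟨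
    ∣ q ∣                     ∎
    where
    open ≤-Reasoning
    ∣p-a∣≡k : ∣ p ∩ ∁ ⁅ a ⁆ ∣ ≡ k
    ∣p-a∣≡k = suc-injective (trans (sym (x∈p⇒∣p∣≡1+∣p∩∁⁅x⁆∣ a∈p)) ∣p∣≡1+k)
    ∈p-a : ∀ {x} → x ∈ p ∩ ∁ ⁅ a ⁆ → x ∈ p × x ≢ a
    ∈p-a {x} x∈ = let x∈p , x∈∁⁅a⁆ = x∈p∩q⁻ p _ x∈ in
      x∈p , (λ x≡a → x∈∁p⇒x∉p x∈∁⁅a⁆ (subst (_∈ ⁅ a ⁆) (sym x≡a) (x∈⁅x⁆ a)))
    into′ : ∀ {x} → x ∈ p ∩ ∁ ⁅ a ⁆ → f x ∈ q ∩ ∁ ⁅ f a ⁆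
    into′ x∈ = let x∈p , x≢a = ∈p-a x∈ in
      x∈p∩q⁺ (into x∈p , x∉p⇒x∈∁p (x≢a ∘ injective x∈p a∈p ∘ x∈⁅y⁆⇒x≡y _))
    injective′ : ∀ {x y} → x ∈ p ∩ ∁ ⁅ a ⁆ → y ∈ p ∩ ∁ ⁅ a ⁆ → f x ≡ f y → x ≡ y
    injective′ x∈ y∈ = injective (proj₁ (∈p-a x∈)) (proj₁ (∈p-a y∈))

⊆∧≢⇒∣p∣<∣q∣ : {p q : Subset n} → p ⊆ q → p ≢ q → ∣ p ∣ < ∣ q ∣
⊆∧≢⇒∣p∣<∣q∣ {p = p} {q} p⊆q p≢q with any? (λ x → x ∈? q ×-dec ¬? (x ∈? p))
... | yes (x , x∈q , x∉p) = p⊂q⇒∣p∣<∣q∣ (p⊆q , x , x∈q , x∉p)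
... | no ∄x = contradiction
  (⊆-antisym p⊆q (λ {x} x∈q → decidable-stable (x ∈? p) (λ x∉p → ∄x (x , x∈q , x∉p)))) p≢q

q⊆r⇒∣p∩r∣≡∣p∩q∣+∣p∩r∩∁q∣ : (p : Subset n) {q r : Subset n} → q ⊆ r →
                            ∣ p ∩ r ∣ ≡ ∣ p ∩ q ∣ + ∣ p ∩ r ∩ ∁ q ∣
q⊆r⇒∣p∩r∣≡∣p∩q∣+∣p∩r∩∁q∣ p {q} {r} q⊆r = begin
  ∣ p ∩ r ∣                           ≡⟨ ∣p∣≡∣p∩q∣+∣p∩∁q∣ (p ∩ r) q ⟩
  ∣ (p ∩ r) ∩ q ∣ + ∣ (p ∩ r) ∩ ∁ q ∣ ≡⟨ cong₂ (λ a b → ∣ a ∣ + ∣ b ∣) p∩r∩q≡p∩q (∩-assoc p r (∁ q)) ⟩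
  ∣ p ∩ q ∣ + ∣ p ∩ r ∩ ∁ q ∣         ∎
  where
  open ≡-Reasoning
  p∩r∩q≡p∩q : (p ∩ r) ∩ q ≡ p ∩ q
  p∩r∩q≡p∩q = trans (∩-assoc p r q) (cong (p ∩_) (⊆-antisym (p∩q⊆q r q) (λ x∈q → x∈p∩q⁺ (q⊆r x∈q , x∈q))))

find : {P : Fin n → Set} → Decidable P → Fin n → Fin n
find P? default with any? P?
... | yes (x , _) = x
... | no _        = default

find-sound : {P : Fin n → Set} (P? : Decidable P) (default : Fin n) → ∃ P → P (find P? default)
find-sound P? default ∃P with any? P?
... | yes (_ , Px) = Px
... | no ∄P        = contradiction ∃P ∄P

fromDec : {P : Fin n → Set} → Decidable P → Subset n
fromDec P? = tabulate (λ x → isYes (P? x))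

∈fromDec⇔ : {P : Fin n → Set} (P? : Decidable P) {x : Fin n} → x ∈ fromDec P? ⇔ P x
∈fromDec⇔ P? {x} = mk⇔
  (toWitness ∘ subst T (lookup∘tabulate (λ x → isYes (P? x)) x) ∘ to ∈⇔T-lookup)
  (from ∈⇔T-lookup ∘ subst T (sym (lookup∘tabulate (λ x → isYes (P? x)) x)) ∘ fromWitness)

image : (Fin n → Fin n) → Subset n → Subset n
image f p = fromDec (λ y → any? (λ x → x ∈? p ×-dec f x ≟ y))

module _ {f : Fin n → Fin n} {p : Subset n} where

  ∈image⁺ : ∀ {x} → x ∈ p → f x ∈ image f p
  ∈image⁺ {x} x∈p = from (∈fromDec⇔ (λ y → any? (λ x → x ∈? p ×-dec f x ≟ y))) (x , x∈p , refl)

  ∈image⁻ : ∀ {y} → y ∈ image f p → ∃ λ x → x ∈ p × f x ≡ y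
  ∈image⁻ = to (∈fromDec⇔ (λ y → any? (λ x → x ∈? p ×-dec f x ≟ y)))

  ∣image∣≤∣p∣ : ∣ image f p ∣ ≤ ∣ p ∣
  ∣image∣≤∣p∣ = injection⇒∣p∣≤∣q∣ (image f p) p preimage (proj₁ ∘ preimage-sound)
    λ y∈ y′∈ same → trans (sym (proj₂ (preimage-sound y∈))) (trans (cong f same) (proj₂ (preimage-sound y′∈)))
    where
    preimage : Fin n → Fin n
    preimage y = find (λ x → x ∈? p ×-dec f x ≟ y) y
    preimage-sound : ∀ {y} → y ∈ image f p → preimage y ∈ p × f (preimage y) ≡ y
    preimage-sound {y} y∈ = find-sound (λ x → x ∈? p ×-dec f x ≟ y) y (∈image⁻ y∈)

∈-allSubsets : (p : Subset n) → p ∈ˡ allSubsets n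
∈-allSubsets Vec.[] = Any.here refl
∈-allSubsets {suc n} (outside ∷ p) = ∈-++⁺ˡ (∈-map⁺ (outside ∷_) (∈-allSubsets p))
∈-allSubsets {suc n} (inside ∷ p) =
  ∈-++⁺ʳ (Data.List.map (outside ∷_) (allSubsets n)) (∈-map⁺ (inside ∷_) (∈-allSubsets p))

∈⇒≤foldr-⊔ : ∀ {x e xs} → x ∈ˡ xs → x ≤ Data.List.foldr _⊔_ e xs
∈⇒≤foldr-⊔ {e = e} {xs} x∈xs =
  foldr-preservesᵒ (λ a b → [ m≤n⇒m≤n⊔o b , m≤n⇒m≤o⊔n a ]′) e xs (inj₂ (lose x∈xs ≤-refl))

∈⇒foldr-⊓≤ : ∀ {x e xs} → x ∈ˡ xs → Data.List.foldr _⊓_ e xs ≤ x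
∈⇒foldr-⊓≤ {e = e} {xs} x∈xs =
  foldr-preservesᵒ (λ a b → [ m≤n⇒m⊓o≤n b , m≤n⇒o⊓m≤n a ]′) e xs (inj₂ (lose x∈xs ≤-refl))

module _ (G : Graph n) where

  Edge-sym : ∀ {u v} → Edge G u v → Edge G v u
  Edge-sym {u} {v} e = trans (Graph.sym G v u) e

  Edge? : ∀ u v → Dec (Edge G u v)
  Edge? u v = adj G u v Data.Bool.≟ true

  Edge-irrefl : ∀ {v} → ¬ Edge G v v
  Edge-irrefl {v} e = contradiction (trans (sym e) (irrefl G v)) λ ()

  IndependentIn : Subset n → Subset n → Set
  IndependentIn S X = X ⊆ S × Independent G X

  MaximalIndependentIn : Subset n → Subset n → Set
  MaximalIndependentIn S X = IndependentIn S X × S ⊆ X ∪ N G X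

  ∈N⇔T-any : ∀ {X v} → v ∈ N G X ⇔ T (any (λ u → lookup X u ∧ adj G u v) (allFin n))
  ∈N⇔T-any {X} {v} = mk⇔ (subst T lookup-N ∘ to ∈⇔T-lookup) (from ∈⇔T-lookup ∘ subst T (sym lookup-N))
    where lookup-N = lookup∘tabulate (λ v → any (λ u → lookup X u ∧ adj G u v) (allFin n)) v

  ∈N⁺ : ∀ {X u v} → u ∈ X → Edge G u v → v ∈ N G X
  ∈N⁺ {X} {u} {v} u∈X e =
    from (∈N⇔T-any {X} {v}) (from (T-any-allFin (λ u → lookup X u ∧ adj G u v)) (u , from T-∧ (to ∈⇔T-lookup u∈X , from T-≡ e)))

  ∈N⁻ : ∀ X {v} → v ∈ N G X → ∃ λ u → u ∈ X × Edge G u v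
  ∈N⁻ X {v} v∈N = let u , t = to (T-any-allFin (λ u → lookup X u ∧ adj G u v)) (to (∈N⇔T-any {X} {v}) v∈N)
                      tu , te = to T-∧ t in
    u , from ∈⇔T-lookup tu , to T-≡ te

  N-mono : ∀ {X Y} → X ⊆ Y → N G X ⊆ N G Y
  N-mono {X} X⊆Y v∈N = let u , u∈X , e = ∈N⁻ X v∈N in ∈N⁺ (X⊆Y u∈X) e

  ∪N-mono : ∀ {X Y} → X ⊆ Y → X ∪ N G X ⊆ Y ∪ N G Y
  ∪N-mono {X} {Y} X⊆Y v∈ = [ p⊆p∪q (N G Y) ∘ X⊆Y , q⊆p∪q Y (N G Y) ∘ N-mono X⊆Y ]′ (x∈p∪q⁻ X (N G X) v∈)

  Independent⇒∉N : ∀ {X x} → Independent G X → x ∈ X → x ∉ N G X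
  Independent⇒∉N {X} ind x∈X x∈N = let u , u∈X , e = ∈N⁻ X x∈N in ind u _ u∈X x∈X e

  subsetᵇ⇔⊆ : ∀ {X S} → T (subsetᵇ G X S) ⇔ X ⊆ S
  subsetᵇ⇔⊆ {X} {S} = mk⇔
    (λ t {x} x∈X → from ∈⇔T-lookup (to T-not-∨⇔→ (to (T-all-allFin _) t x) (to ∈⇔T-lookup x∈X)))
    (λ X⊆S → from (T-all-allFin (λ v → not (lookup X v) ∨ lookup S v))
      (λ x → from T-not-∨⇔→ (λ t → to ∈⇔T-lookup (X⊆S (from (∈⇔T-lookup {p = X}) t)))))

  independentᵇ⇔Independent : ∀ {X} → T (independentᵇ G X) ⇔ Independent G X
  independentᵇ⇔Independent = mk⇔
    (λ t u v u∈X v∈X e → to T-not⇔¬T (to (T-all-allFin _) (to (T-all-allFin _) t u) v)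
      (from T-∧ (to ∈⇔T-lookup u∈X , from T-∧ (to ∈⇔T-lookup v∈X , from T-≡ e))))
    (λ ind → from (T-all-allFin _) λ u → from (T-all-allFin _) λ v → from T-not⇔¬T λ t →
      let tu , t′ = to T-∧ t ; tv , te = to T-∧ t′ in
      ind u v (from ∈⇔T-lookup tu) (from ∈⇔T-lookup tv) (to T-≡ te))

  dominatedᵇ⇔⊆ : ∀ {X S} →
    T (all (λ v → not (lookup S v) ∨ lookup X v ∨ any (λ u → lookup X u ∧ adj G u v) (allFin n)) (allFin n))
    ⇔ S ⊆ X ∪ N G X
  dominatedᵇ⇔⊆ {X} {S} = mk⇔
    (λ t {v} v∈S → x∈p∪q⁺ (Data.Sum.map (from ∈⇔T-lookup) (from (∈N⇔T-any {X} {v}))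
      (to T-∨ (to T-not-∨⇔→ (to (T-all-allFin dominated) t v) (to ∈⇔T-lookup v∈S)))))
    (λ S⊆ → from (T-all-allFin dominated) λ v → from T-not-∨⇔→ λ tv → from T-∨
      (Data.Sum.map (to ∈⇔T-lookup) (to (∈N⇔T-any {X} {v})) (x∈p∪q⁻ X (N G X) (S⊆ (from ∈⇔T-lookup tv)))))
    where
    dominated = λ v → not (lookup S v) ∨ lookup X v ∨ any (λ u → lookup X u ∧ adj G u v) (allFin n)

  maximalIndepInᵇ⇔ : ∀ {S X} → T (maximalIndepInᵇ G S X) ⇔ MaximalIndependentIn S X
  maximalIndepInᵇ⇔ {S} {X} = mk⇔ toMaximal fromMaximal
    where
    toMaximal : T (maximalIndepInᵇ G S X) → MaximalIndependentIn S X
    toMaximal t = let t⊆ , t′ = to T-∧ t ; tind , tdom = to T-∧ t′ in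
      (to subsetᵇ⇔⊆ t⊆ , to independentᵇ⇔Independent tind) , to dominatedᵇ⇔⊆ tdom
    fromMaximal : MaximalIndependentIn S X → T (maximalIndepInᵇ G S X)
    fromMaximal ((X⊆S , ind) , dom) =
      from T-∧ (from subsetᵇ⇔⊆ X⊆S , from T-∧ (from independentᵇ⇔Independent ind , from dominatedᵇ⇔⊆ dom))

  private
    isIndependentIn : Subset n → Subset n → Bool
    isIndependentIn S X = subsetᵇ G X S ∧ independentᵇ G X

    isIndependentIn⇔ : ∀ {S X} → T (isIndependentIn S X) ⇔ IndependentIn S X
    isIndependentIn⇔ {S} {X} = mk⇔ toIndependentIn fromIndependentIn
      where
      toIndependentIn : T (isIndependentIn S X) → IndependentIn S X
      toIndependentIn t = let t⊆ , tind = to T-∧ t in to subsetᵇ⇔⊆ t⊆ , to independentᵇ⇔Independent tind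
      fromIndependentIn : IndependentIn S X → T (isIndependentIn S X)
      fromIndependentIn (X⊆S , ind) = from T-∧ (from subsetᵇ⇔⊆ X⊆S , from independentᵇ⇔Independent ind)

  ∣X∣≤α : ∀ {S X} → IndependentIn S X → ∣ X ∣ ≤ α G S
  ∣X∣≤α {S} {X} indep = ∈⇒≤foldr-⊔
    (∈-map⁺ ∣_∣ (∈-filter⁺ (T? ∘ isIndependentIn S) (∈-allSubsets X) (from isIndependentIn⇔ indep)))

  α-attained : ∀ S → ∃ λ X → IndependentIn S X × ∣ X ∣ ≡ α G S
  α-attained S with foldr-selective ⊔-sel 0 (Data.List.map ∣_∣ (filterᵇ (isIndependentIn S) (allSubsets n)))
  ... | inj₁ α≡0 = ∅ , (⊥⊆ , λ _ _ u∈∅ → contradiction u∈∅ ∉⊥) , trans (∣⊥∣≡0 n) (sym α≡0)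
  ... | inj₂ α∈ with ∈-map∘filter⁻ ∣_∣ (T? ∘ isIndependentIn S) {xs = allSubsets n} α∈
  ...   | X , _ , α≡∣X∣ , t = X , to isIndependentIn⇔ t , sym α≡∣X∣

  i≤∣X∣ : ∀ {S X} → MaximalIndependentIn S X → iNum G S ≤ ∣ X ∣
  i≤∣X∣ {S} {X} maximal = ∈⇒foldr-⊓≤
    (∈-map⁺ ∣_∣ (∈-filter⁺ (T? ∘ maximalIndepInᵇ G S) (∈-allSubsets X) (from maximalIndepInᵇ⇔ maximal)))

  maximum⇒maximal : ∀ {S X} → IndependentIn S X → ∣ X ∣ ≡ α G S → MaximalIndependentIn S X
  maximum⇒maximal {S} {X} (X⊆S , ind) ∣X∣≡α = (X⊆S , ind) , dominated
    where
    dominated : S ⊆ X ∪ N G X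
    dominated {v} v∈S with v ∈? X ∪ N G X
    ... | yes v∈ = v∈
    ... | no v∉ = contradiction (∣X∣≤α (X+v⊆S , X+v-independent)) (<⇒≱ α<∣X+v∣)
      where
      v∉X : v ∉ X
      v∉X = v∉ ∘ p⊆p∪q (N G X)
      v∉NX : v ∉ N G X
      v∉NX = v∉ ∘ q⊆p∪q X (N G X)
      cases : ∀ {x} → x ∈ X ∪ ⁅ v ⁆ → x ∈ X ⊎ x ≡ v
      cases x∈ = Data.Sum.map₂ (x∈⁅y⁆⇒x≡y v) (x∈p∪q⁻ X ⁅ v ⁆ x∈)
      X+v⊆S : X ∪ ⁅ v ⁆ ⊆ S
      X+v⊆S x∈ = [ X⊆S , (λ { refl → v∈S }) ]′ (cases x∈)
      X+v-independent : Independent G (X ∪ ⁅ v ⁆)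
      X+v-independent a b a∈ b∈ e with cases a∈ | cases b∈
      ... | inj₁ a∈X | inj₁ b∈X = ind a b a∈X b∈X e
      ... | inj₁ a∈X | inj₂ refl = v∉NX (∈N⁺ a∈X e)
      ... | inj₂ refl | inj₁ b∈X = v∉NX (∈N⁺ b∈X (Edge-sym e))
      ... | inj₂ refl | inj₂ refl = Edge-irrefl e
      α<∣X+v∣ : α G S < ∣ X ∪ ⁅ v ⁆ ∣
      α<∣X+v∣ = begin-strict
        α G S             ≡⟨ ∣X∣≡α ⟨
        ∣ X ∣             <⟨ m<m+n ∣ X ∣ (s≤s z≤n) ⟩
        ∣ X ∣ + 1         ≡⟨ cong (∣ X ∣ +_) (∣⁅x⁆∣≡1 v) ⟨
        ∣ X ∣ + ∣ ⁅ v ⁆ ∣ ≡⟨ disjoint⇒∣p∪q∣≡∣p∣+∣q∣ X ⁅ v ⁆ (λ x∈X x∈⁅v⁆ → v∉X (subst (_∈ X) (x∈⁅y⁆⇒x≡y v x∈⁅v⁆) x∈X)) ⟨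
        ∣ X ∪ ⁅ v ⁆ ∣     ∎
        where open ≤-Reasoning

  maximal-exists : ∀ S → ∃ (MaximalIndependentIn S)
  maximal-exists S = let X , indep , ∣X∣≡α = α-attained S in X , maximum⇒maximal indep ∣X∣≡α

  i-attained : ∀ S → ∃ λ X → MaximalIndependentIn S X × ∣ X ∣ ≡ iNum G S
  i-attained S with foldr-selective ⊓-sel n (Data.List.map ∣_∣ (filterᵇ (maximalIndepInᵇ G S) (allSubsets n)))
  ... | inj₂ i∈ with ∈-map∘filter⁻ ∣_∣ (T? ∘ maximalIndepInᵇ G S) {xs = allSubsets n} i∈
  ...   | X , _ , i≡∣X∣ , t = X , to maximalIndepInᵇ⇔ t , sym i≡∣X∣
  i-attained S | inj₁ i≡n with maximal-exists S
  ... | X , maximal = X , maximal , ≤-antisym (≤-trans (∣p∣≤n X) (≤-reflexive (sym i≡n))) (i≤∣X∣ maximal)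

  i≤α : ∀ S → iNum G S ≤ α G S
  i≤α S = let X , indep , ∣X∣≡α = α-attained S in
    ≤-trans (i≤∣X∣ (maximum⇒maximal indep ∣X∣≡α)) (≤-reflexive ∣X∣≡α)

  α-mono : ∀ {S S′} → S ⊆ S′ → α G S ≤ α G S′
  α-mono {S} S⊆S′ = let X , (X⊆S , ind) , ∣X∣≡α = α-attained S in
    ≤-trans (≤-reflexive (sym ∣X∣≡α)) (∣X∣≤α (S⊆S′ ∘ X⊆S , ind))

  α≤∣S∣ : ∀ S → α G S ≤ ∣ S ∣
  α≤∣S∣ S = let X , (X⊆S , _) , ∣X∣≡α = α-attained S in
    ≤-trans (≤-reflexive (sym ∣X∣≡α)) (p⊆q⇒∣p∣≤∣q∣ X⊆S)

  μα≤e⇔α≤i+e : ∀ S {e} → μα G S ≤ e ⇔ α G S ≤ iNum G S + e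
  μα≤e⇔α≤i+e S = m∸n≤o⇔m≤n+o

  WellCovered⇔α≤i+0 : ∀ S → WellCovered G S ⇔ α G S ≤ iNum G S + 0
  WellCovered⇔α≤i+0 S = mk⇔ (to (μα≤e⇔α≤i+e S) ∘ ≤-reflexive) (n≤0⇒n≡0 ∘ from (μα≤e⇔α≤i+e S))

  α-split : ∀ S A → (∀ {a b} → a ∈ S ∩ A → b ∈ S ∩ ∁ A → ¬ Edge G a b) →
            α G S ≡ α G (S ∩ A) + α G (S ∩ ∁ A)
  α-split S A separated = ≤-antisym α≤ ≤α
    where
    open ≤-Reasoning
    ∩-IndependentIn : ∀ {X} B → IndependentIn S X → IndependentIn (S ∩ B) (X ∩ B)
    ∩-IndependentIn {X} B (X⊆S , ind) =
      (λ x∈ → let x∈X , x∈B = x∈p∩q⁻ X B x∈ in x∈p∩q⁺ (X⊆S x∈X , x∈B)) ,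
      (λ a b a∈ b∈ → ind a b (p∩q⊆p X B a∈) (p∩q⊆p X B b∈))
    α≤ : α G S ≤ α G (S ∩ A) + α G (S ∩ ∁ A)
    α≤ with α-attained S
    ... | X , indep , ∣X∣≡α = begin
      α G S                             ≡⟨ ∣X∣≡α ⟨
      ∣ X ∣                             ≡⟨ ∣p∣≡∣p∩q∣+∣p∩∁q∣ X A ⟩
      ∣ X ∩ A ∣ + ∣ X ∩ ∁ A ∣           ≤⟨ +-mono-≤ (∣X∣≤α (∩-IndependentIn A indep)) (∣X∣≤α (∩-IndependentIn (∁ A) indep)) ⟩
      α G (S ∩ A) + α G (S ∩ ∁ A)       ∎
    ≤α : α G (S ∩ A) + α G (S ∩ ∁ A) ≤ α G S
    ≤α with α-attained (S ∩ A) | α-attained (S ∩ ∁ A)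
    ... | X₁ , (X₁⊆ , ind₁) , ∣X₁∣≡α | X₂ , (X₂⊆ , ind₂) , ∣X₂∣≡α = begin
      α G (S ∩ A) + α G (S ∩ ∁ A)   ≡⟨ cong₂ _+_ ∣X₁∣≡α ∣X₂∣≡α ⟨
      ∣ X₁ ∣ + ∣ X₂ ∣               ≡⟨ disjoint⇒∣p∪q∣≡∣p∣+∣q∣ X₁ X₂ X₁-disjoint-X₂ ⟨
      ∣ X₁ ∪ X₂ ∣                   ≤⟨ ∣X∣≤α (X₁∪X₂⊆S , X₁∪X₂-independent) ⟩
      α G S                         ∎
      where
      X₁-disjoint-X₂ : ∀ {x} → x ∈ X₁ → x ∉ X₂
      X₁-disjoint-X₂ x∈X₁ x∈X₂ = x∈p⇒x∉∁p (p∩q⊆q S A (X₁⊆ x∈X₁)) (p∩q⊆q S (∁ A) (X₂⊆ x∈X₂))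
      X₁∪X₂⊆S : X₁ ∪ X₂ ⊆ S
      X₁∪X₂⊆S x∈ = [ p∩q⊆p S A ∘ X₁⊆ , p∩q⊆p S (∁ A) ∘ X₂⊆ ]′ (x∈p∪q⁻ X₁ X₂ x∈)
      X₁∪X₂-independent : Independent G (X₁ ∪ X₂)
      X₁∪X₂-independent a b a∈ b∈ e with x∈p∪q⁻ X₁ X₂ a∈ | x∈p∪q⁻ X₁ X₂ b∈
      ... | inj₁ a∈X₁ | inj₁ b∈X₁ = ind₁ a b a∈X₁ b∈X₁ e
      ... | inj₁ a∈X₁ | inj₂ b∈X₂ = separated (X₁⊆ a∈X₁) (X₂⊆ b∈X₂) e
      ... | inj₂ a∈X₂ | inj₁ b∈X₁ = separated (X₁⊆ b∈X₁) (X₂⊆ a∈X₂) (Edge-sym e)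
      ... | inj₂ a∈X₂ | inj₂ b∈X₂ = ind₂ a b a∈X₂ b∈X₂ e

module _ (G : Graph n) (S : Subset n) where

  EdgeClosed : Subset n → Set
  EdgeClosed C = ∀ {u v} → u ∈ C → v ∈ S → Edge G u v → v ∈ C

  ComponentUnion : Subset n → Set
  ComponentUnion C = C ⊆ S × EdgeClosed C

  ComponentUnion-S : ComponentUnion S
  ComponentUnion-S = (λ v∈S → v∈S) , (λ _ v∈S _ → v∈S)

  ComponentUnion-∪ : ∀ {C D} → ComponentUnion C → ComponentUnion D → ComponentUnion (C ∪ D)
  ComponentUnion-∪ {C} {D} (C⊆S , C-closed) (D⊆S , D-closed) =
    (λ x∈ → [ C⊆S , D⊆S ]′ (x∈p∪q⁻ C D x∈)) ,
    (λ u∈ v∈S e → [ p⊆p∪q D ∘ (λ u∈C → C-closed u∈C v∈S e) , q⊆p∪q C D ∘ (λ u∈D → D-closed u∈D v∈S e) ]′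
                    (x∈p∪q⁻ C D u∈))

  ComponentUnion-─ : ∀ {C D} → ComponentUnion C → ComponentUnion D → ComponentUnion (C ∩ ∁ D)
  ComponentUnion-─ {C} {D} (C⊆S , C-closed) (_ , D-closed) =
    C⊆S ∘ p∩q⊆p C (∁ D) ,
    λ u∈ v∈S e → let u∈C , u∈∁D = x∈p∩q⁻ C (∁ D) u∈ in
      x∈p∩q⁺ (C-closed u∈C v∈S e , x∉p⇒x∈∁p (x∈∁p⇒x∉p u∈∁D ∘ λ v∈D → D-closed v∈D (C⊆S u∈C) (Edge-sym G e)))

  α-ComponentUnion-split : ∀ {C D} → ComponentUnion C → ComponentUnion D → D ⊆ C →
                           α G C ≡ α G D + α G (C ∩ ∁ D)
  α-ComponentUnion-split {C} {D} (C⊆S , _) (_ , D-closed) D⊆C = begin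
    α G C                           ≡⟨ α-split G C D separated ⟩
    α G (C ∩ D) + α G (C ∩ ∁ D)     ≡⟨ cong (λ X → α G X + α G (C ∩ ∁ D)) C∩D≡D ⟩
    α G D + α G (C ∩ ∁ D)           ∎
    where
    open ≡-Reasoning
    C∩D≡D : C ∩ D ≡ D
    C∩D≡D = ⊆-antisym (p∩q⊆q C D) (λ x∈D → x∈p∩q⁺ (D⊆C x∈D , x∈D))
    separated : ∀ {a b} → a ∈ C ∩ D → b ∈ C ∩ ∁ D → ¬ Edge G a b
    separated a∈ b∈ e = let b∈C , b∈∁D = x∈p∩q⁻ C (∁ D) b∈ in
      x∈∁p⇒x∉p b∈∁D (D-closed (p∩q⊆q C D a∈) (C⊆S b∈C) e)

  grow : Subset n → Subset n
  grow C = C ∪ (S ∩ N G C)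

  growⁿ : ℕ → Subset n → Subset n
  growⁿ zero    C = C
  growⁿ (suc k) C = growⁿ k (grow C)

  ⊆grow : ∀ {C} → C ⊆ grow C
  ⊆grow {C} = p⊆p∪q (S ∩ N G C)

  ⊆growⁿ : ∀ k {C} → C ⊆ growⁿ k C
  ⊆growⁿ zero    = λ x∈ → x∈
  ⊆growⁿ (suc k) = ⊆growⁿ k ∘ ⊆grow

  ∈grow⁻ : ∀ {C v} → v ∈ grow C → v ∈ C ⊎ (v ∈ S × ∃ λ u → u ∈ C × Edge G u v)
  ∈grow⁻ {C} v∈ = Data.Sum.map₂ (λ v∈S∩N → let v∈S , v∈N = x∈p∩q⁻ S (N G C) v∈S∩N in v∈S , ∈N⁻ G C v∈N)
                                (x∈p∪q⁻ C (S ∩ N G C) v∈)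

  grow-fixed⇒EdgeClosed : ∀ {C} → grow C ≡ C → EdgeClosed C
  grow-fixed⇒EdgeClosed {C} fixed {u} u∈C v∈S e =
    subst (_ ∈_) fixed (q⊆p∪q C (S ∩ N G C) (x∈p∩q⁺ (v∈S , ∈N⁺ G u∈C e)))

  growⁿ-EdgeClosed : ∀ k C → n ≤ k + ∣ C ∣ → EdgeClosed (growⁿ k C)
  growⁿ-EdgeClosed zero C n≤∣C∣ {v = v} _ _ _ =
    subst (v ∈_) (sym (∣p∣≡n⇒p≡⊤ (≤-antisym (∣p∣≤n C) n≤∣C∣))) ∈⊤
  growⁿ-EdgeClosed (suc k) C n≤ with ≡-dec Data.Bool._≟_ (grow C) C
  ... | yes fixed = subst EdgeClosed (sym (growⁿ-fixed k)) (grow-fixed⇒EdgeClosed fixed)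
    where
    growⁿ-fixed : ∀ k → growⁿ k (grow C) ≡ C
    growⁿ-fixed zero    = fixed
    growⁿ-fixed (suc k) = trans (cong (growⁿ k ∘ grow) fixed) (growⁿ-fixed k)
  ... | no grows = growⁿ-EdgeClosed k (grow C) (begin
    n                    ≤⟨ n≤ ⟩
    suc k + ∣ C ∣        ≡⟨ +-suc k ∣ C ∣ ⟨
    k + suc ∣ C ∣        ≤⟨ +-monoʳ-≤ k (⊆∧≢⇒∣p∣<∣q∣ ⊆grow (grows ∘ sym)) ⟩
    k + ∣ grow C ∣       ∎)
    where open ≤-Reasoning

  ReachIn-source : ∀ {u w} → ReachIn G S u w → u ∈ S
  ReachIn-source (here u∈S)     = u∈S
  ReachIn-source (step u∈S _ _) = u∈S

  ReachIn-snoc : ∀ {v w u} → ReachIn G S v w → Edge G w u → u ∈ S → ReachIn G S v u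
  ReachIn-snoc (here w∈S)       e u∈S = step w∈S e (here u∈S)
  ReachIn-snoc (step v∈S e′ r) e u∈S = step v∈S e′ (ReachIn-snoc r e u∈S)

  EdgeClosed-ReachIn : ∀ {C u w} → EdgeClosed C → u ∈ C → ReachIn G S u w → w ∈ C
  EdgeClosed-ReachIn closed u∈C (here _)     = u∈C
  EdgeClosed-ReachIn closed u∈C (step _ e r) = EdgeClosed-ReachIn closed (closed u∈C (ReachIn-source r) e) r

  growⁿ-⊆ : ∀ k {C} → C ⊆ S → growⁿ k C ⊆ S
  growⁿ-⊆ zero    C⊆S = C⊆S
  growⁿ-⊆ (suc k) {C} C⊆S = growⁿ-⊆ k ([ C⊆S , proj₁ ]′ ∘ ∈grow⁻)

  growⁿ-reachable : ∀ k {v C} → (∀ {u} → u ∈ C → ReachIn G S v u) →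
                    ∀ {u} → u ∈ growⁿ k C → ReachIn G S v u
  growⁿ-reachable zero    reach = reach
  growⁿ-reachable (suc k) reach = growⁿ-reachable k λ u∈ →
    [ reach , (λ (u∈S , w , w∈C , e) → ReachIn-snoc (reach w∈C) e u∈S) ]′ (∈grow⁻ u∈)

  -- n rounds suffice, since every round that is not a fixed point adds a vertex.
  component : Fin n → Subset n
  component v = growⁿ n ⁅ v ⁆

  module _ {v} (v∈S : v ∈ S) where

    ∈component : v ∈ component v
    ∈component = ⊆growⁿ n (x∈⁅x⁆ v)

    component-ComponentUnion : ComponentUnion (component v)
    component-ComponentUnion =
      growⁿ-⊆ n (λ u∈⁅v⁆ → subst (_∈ S) (sym (x∈⁅y⁆⇒x≡y v u∈⁅v⁆)) v∈S) ,
      growⁿ-EdgeClosed n ⁅ v ⁆ (≤-trans (m≤m+n n 1) (≤-reflexive (cong (n +_) (sym (∣⁅x⁆∣≡1 v)))))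

    component⇔ReachIn : ∀ {u} → u ∈ component v ⇔ ReachIn G S v u
    component⇔ReachIn = mk⇔
      (growⁿ-reachable n (λ u∈⁅v⁆ → subst (ReachIn G S v) (sym (x∈⁅y⁆⇒x≡y v u∈⁅v⁆)) (here v∈S)))
      (EdgeClosed-ReachIn (proj₂ component-ComponentUnion) ∈component)

    component-⊆ : ∀ {C} → ComponentUnion C → v ∈ C → component v ⊆ C
    component-⊆ (_ , C-closed) v∈C = EdgeClosed-ReachIn C-closed v∈C ∘ to component⇔ReachIn

    component-CompSize : CompSize G S v ∣ component v ∣
    component-CompSize = component v , (λ _ → component⇔ReachIn) , refl

  α-disjoint-∪ : ∀ {C D} → ComponentUnion C → ComponentUnion D → (∀ {x} → x ∈ C → x ∉ D) →
                 α G (C ∪ D) ≡ α G C + α G D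
  α-disjoint-∪ {C} {D} C-union D-union disjoint = begin
    α G (C ∪ D)                   ≡⟨ α-ComponentUnion-split (ComponentUnion-∪ C-union D-union) C-union (p⊆p∪q D) ⟩
    α G C + α G ((C ∪ D) ∩ ∁ C)   ≡⟨ cong (λ X → α G C + α G X) (disjoint⇒[p∪q]∩∁p≡q C D disjoint) ⟩
    α G C + α G D                 ∎
    where open ≡-Reasoning

  α≤∣J∩T∣-by-components : ∀ J {T} → ComponentUnion T →
    (∀ {v} → v ∈ T → α G (component v) ≤ ∣ J ∩ component v ∣) → α G T ≤ ∣ J ∩ T ∣
  α≤∣J∩T∣-by-components J {T} T-union each = go ∣ T ∣ T-union ≤-refl each
    where
    go : ∀ k {T} → ComponentUnion T → ∣ T ∣ ≤ k →
         (∀ {v} → v ∈ T → α G (component v) ≤ ∣ J ∩ component v ∣) → α G T ≤ ∣ J ∩ T ∣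
    go k {T} T-union ∣T∣≤k each with nonempty? T
    ... | no T-empty = ≤-trans (α≤∣S∣ G T) (≤-trans (≤-reflexive ∣T∣≡0) z≤n)
      where ∣T∣≡0 = trans (cong ∣_∣ (Empty-unique T-empty)) (∣⊥∣≡0 n)
    go zero    T-union ∣T∣≤0 each | yes (v , v∈T) = contradiction (≤-trans (x∈p⇒∣p∣>0 v∈T) ∣T∣≤0) λ ()
    go (suc k) {T} T-union ∣T∣≤1+k each | yes (v , v∈T) = begin
      α G T                                        ≡⟨ α-ComponentUnion-split T-union C-union C⊆T ⟩
      α G C + α G (T ∩ ∁ C)                        ≤⟨ +-mono-≤ (each v∈T) rest ⟩
      ∣ J ∩ C ∣ + ∣ J ∩ T ∩ ∁ C ∣                  ≡⟨ q⊆r⇒∣p∩r∣≡∣p∩q∣+∣p∩r∩∁q∣ J C⊆T ⟨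
      ∣ J ∩ T ∣                                    ∎
      where
      open ≤-Reasoning
      C = component v
      C-union = component-ComponentUnion (proj₁ T-union v∈T)
      C⊆T = component-⊆ (proj₁ T-union v∈T) T-union v∈T
      ∣T-C∣≤k : ∣ T ∩ ∁ C ∣ ≤ k
      ∣T-C∣≤k = ≤-pred (begin
        suc ∣ T ∩ ∁ C ∣                  ≤⟨ +-monoˡ-≤ ∣ T ∩ ∁ C ∣ (x∈p⇒∣p∣>0 (x∈p∩q⁺ (v∈T , ∈component (proj₁ T-union v∈T)))) ⟩
        ∣ T ∩ C ∣ + ∣ T ∩ ∁ C ∣          ≡⟨ ∣p∣≡∣p∩q∣+∣p∩∁q∣ T C ⟨
        ∣ T ∣                            ≤⟨ ∣T∣≤1+k ⟩
        suc k                            ∎)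
      rest : α G (T ∩ ∁ C) ≤ ∣ J ∩ T ∩ ∁ C ∣
      rest = go k (ComponentUnion-─ T-union C-union) ∣T-C∣≤k (each ∘ p∩q⊆p T (∁ C))

module _ (G : Graph n) where

  InU-edge : ∀ {x y} → Edge G x y → InU G x → InU G y
  InU-edge e x∈U u w y↝u y↝w = x∈U u w (step e y↝u) (step e y↝w)

  leaf⇒¬HasType : ∀ {k w} → Leaf G w → ¬ HasType G k w
  leaf⇒¬HasType (w∉U , _) (inj₁ (w∈U , _))           = w∉U w∈U
  leaf⇒¬HasType leaf      (inj₂ ((_ , ¬leaf) , _))   = ¬leaf leaf

  leaf-neighbour-unique : ∀ {w x x′} → Leaf G w → Edge G w x → Edge G w x′ → x ≡ x′
  leaf-neighbour-unique (w∉U , u , _ , _ , unique) e e′ =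
    trans (unique _ e (w∉U ∘ InU-edge (Edge-sym G e))) (sym (unique _ e′ (w∉U ∘ InU-edge (Edge-sym G e′))))

  type0⇒no-leaf-neighbour : ∀ {v w} → HasType G 0 v → Edge G v w → ¬ Leaf G w
  type0⇒no-leaf-neighbour (inj₁ (v∈U , _)) e (w∉U , _) = w∉U (InU-edge e v∈U)
  type0⇒no-leaf-neighbour (inj₂ (_ , L , L⇔ , ∣L∣≡0)) e leaf =
    contradiction (subst (_> 0) ∣L∣≡0 (x∈p⇒∣p∣>0 (from (L⇔ _) (e , leaf)))) λ ()

  adjacent-leaves⇒InU : ∀ {w w′} → Leaf G w → Leaf G w′ → Edge G w w′ → InU G w
  adjacent-leaves⇒InU {w} {w′} leaf leaf′ e u z w↝u w↝z u≢z = complete (stays (inj₁ refl) w↝u) (stays (inj₁ refl) w↝z) u≢z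
    where
    OneOf : Fin n → Set
    OneOf z = z ≡ w ⊎ z ≡ w′
    stays : ∀ {x z} → OneOf x → Reach G x z → OneOf z
    stays x∈ here = x∈
    stays (inj₁ refl) (step e′ r) = stays (inj₂ (leaf-neighbour-unique leaf e′ e)) r
    stays (inj₂ refl) (step e′ r) = stays (inj₁ (leaf-neighbour-unique leaf′ e′ (Edge-sym G e))) r
    complete : ∀ {u z} → OneOf u → OneOf z → u ≢ z → Edge G u z
    complete (inj₁ refl) (inj₁ refl) u≢z = contradiction refl u≢z
    complete (inj₁ refl) (inj₂ refl) _   = e
    complete (inj₂ refl) (inj₁ refl) _   = Edge-sym G e
    complete (inj₂ refl) (inj₂ refl) u≢z = contradiction refl u≢z

  type1⇒LeafNbrCount : ∀ {v} → HasType G 1 v → LeafNbrCount G v 1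
  type1⇒LeafNbrCount (inj₂ (_ , count)) = count

  type1⇒leaf-neighbour : ∀ {v} → HasType G 1 v → ∃ λ w → Edge G v w × Leaf G w
  type1⇒leaf-neighbour type1 with type1⇒LeafNbrCount type1
  ... | L , L⇔ , ∣L∣≡1 with ∣p∣≢0⇒Nonempty L (λ ∣L∣≡0 → 1+n≢0 (trans (sym ∣L∣≡1) ∣L∣≡0))
  ...   | w , w∈L = w , to (L⇔ w) w∈L

  type1⇒leaf-neighbour-unique : ∀ {v w w′} → HasType G 1 v →
    Edge G v w → Leaf G w → Edge G v w′ → Leaf G w′ → w ≡ w′
  type1⇒leaf-neighbour-unique type1 e leaf e′ leaf′ with type1⇒LeafNbrCount type1
  ... | L , L⇔ , ∣L∣≡1 = ∣p∣≡1⇒x≡y ∣L∣≡1 (from (L⇔ _) (e , leaf)) (from (L⇔ _) (e′ , leaf′))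

module TypesZeroAndOne (G : Graph n) (S₀ S₁ : Subset n)
  (internal-type : ∀ v → Internal G v → HasType G 0 v ⊎ HasType G 1 v)
  (S₀⇔type0 : ∀ v → (v ∈ S₀) ⇔ HasType G 0 v)
  (S₁⇔type1 : ∀ v → (v ∈ S₁) ⇔ HasType G 1 v) where

  Leaves : Subset n
  Leaves = ∁ S₀ ∩ ∁ S₁

  R : Subset n → Subset n
  R I = S₀ ∩ ∁ (N G I)

  S₀-disjoint-S₁ : ∀ {v} → v ∈ S₀ → v ∉ S₁
  S₀-disjoint-S₁ {v} v∈S₀ v∈S₁ with type1⇒leaf-neighbour G (to (S₁⇔type1 v) v∈S₁)
  ... | _ , e , leaf = type0⇒no-leaf-neighbour G (to (S₀⇔type0 v) v∈S₀) e leaf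

  ∈Leaves⁺ : ∀ {v} → v ∉ S₀ → v ∉ S₁ → v ∈ Leaves
  ∈Leaves⁺ v∉S₀ v∉S₁ = x∈p∩q⁺ (x∉p⇒x∈∁p v∉S₀ , x∉p⇒x∈∁p v∉S₁)

  ∈Leaves⇒∉S₀ : ∀ {v} → v ∈ Leaves → v ∉ S₀
  ∈Leaves⇒∉S₀ v∈ = x∈∁p⇒x∉p (p∩q⊆p (∁ S₀) (∁ S₁) v∈)

  ∈Leaves⇒∉S₁ : ∀ {v} → v ∈ Leaves → v ∉ S₁
  ∈Leaves⇒∉S₁ v∈ = x∈∁p⇒x∉p (p∩q⊆q (∁ S₀) (∁ S₁) v∈)

  partition : ∀ v → v ∈ S₀ ⊎ v ∈ S₁ ⊎ v ∈ Leaves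
  partition v with v ∈? S₀ | v ∈? S₁
  ... | yes v∈S₀ | _        = inj₁ v∈S₀
  ... | no _     | yes v∈S₁ = inj₂ (inj₁ v∈S₁)
  ... | no v∉S₀  | no v∉S₁  = inj₂ (inj₂ (∈Leaves⁺ v∉S₀ v∉S₁))

  leaf⇒∈Leaves : ∀ {w} → Leaf G w → w ∈ Leaves
  leaf⇒∈Leaves {w} leaf = ∈Leaves⁺ (leaf⇒¬HasType G leaf ∘ to (S₀⇔type0 w)) (leaf⇒¬HasType G leaf ∘ to (S₁⇔type1 w))

  -- Leaf is not decidable, so membership in Leaves only yields it up to double negation.
  ∈Leaves⇒¬¬leaf : ∀ {w} → w ∈ Leaves → ¬ ¬ Leaf G w
  ∈Leaves⇒¬¬leaf {w} w∈ ¬leaf = [ ∈Leaves⇒∉S₀ w∈ ∘ from (S₀⇔type0 w) , ∈Leaves⇒∉S₁ w∈ ∘ from (S₁⇔type1 w) ]′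
    (internal-type w (w∉U , ¬leaf))
    where
    w∉U : ¬ InU G w
    w∉U w∈U = ∈Leaves⇒∉S₀ w∈ (from (S₀⇔type0 w) (inj₁ (w∈U , refl)))

  Leaves-S₀-nonadjacent : ∀ {w x} → w ∈ Leaves → x ∈ S₀ → ¬ Edge G w x
  Leaves-S₀-nonadjacent {x = x} w∈ x∈S₀ e =
    ∈Leaves⇒¬¬leaf w∈ (type0⇒no-leaf-neighbour G (to (S₀⇔type0 x) x∈S₀) (Edge-sym G e))

  Leaves-independent : Independent G Leaves
  Leaves-independent w w′ w∈ w′∈ e = ∈Leaves⇒¬¬leaf w∈ λ leaf → ∈Leaves⇒¬¬leaf w′∈ λ leaf′ →
    proj₁ leaf (adjacent-leaves⇒InU G leaf leaf′ e)

  Leaves-neighbour∈S₁ : ∀ {w x} → w ∈ Leaves → Edge G w x → x ∈ S₁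
  Leaves-neighbour∈S₁ {w} {x} w∈ e with partition x
  ... | inj₁ x∈S₀         = contradiction e (Leaves-S₀-nonadjacent w∈ x∈S₀)
  ... | inj₂ (inj₁ x∈S₁)  = x∈S₁
  ... | inj₂ (inj₂ x∈)    = contradiction e (Leaves-independent w x w∈ x∈)

  Leaves-neighbour-unique : ∀ {w x x′} → w ∈ Leaves → Edge G w x → Edge G w x′ → x ≡ x′
  Leaves-neighbour-unique {x = x} {x′} w∈ e e′ =
    decidable-stable (x ≟ x′) λ x≢x′ → ∈Leaves⇒¬¬leaf w∈ λ leaf → x≢x′ (leaf-neighbour-unique G leaf e e′)

  S₁-Leaves-neighbour : ∀ {v} → v ∈ S₁ → ∃ λ w → w ∈ Leaves × Edge G v w
  S₁-Leaves-neighbour {v} v∈S₁ =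
    let w , e , leaf = type1⇒leaf-neighbour G (to (S₁⇔type1 v) v∈S₁) in w , leaf⇒∈Leaves leaf , e

  S₁-Leaves-neighbour-unique : ∀ {v w w′} → v ∈ S₁ → w ∈ Leaves → w′ ∈ Leaves →
                               Edge G v w → Edge G v w′ → w ≡ w′
  S₁-Leaves-neighbour-unique {v} {w} {w′} v∈S₁ w∈ w′∈ e e′ = decidable-stable (w ≟ w′) λ w≢w′ →
    ∈Leaves⇒¬¬leaf w∈ λ leaf → ∈Leaves⇒¬¬leaf w′∈ λ leaf′ →
    w≢w′ (type1⇒leaf-neighbour-unique G (to (S₁⇔type1 v) v∈S₁) e leaf e′ leaf′)

  private
    leafOf : Fin n → Fin n
    leafOf v = find (λ w → w ∈? Leaves ×-dec Edge? G v w) v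

    leafOf-sound : ∀ {v} → v ∈ S₁ → leafOf v ∈ Leaves × Edge G v (leafOf v)
    leafOf-sound {v} v∈S₁ = find-sound (λ w → w ∈? Leaves ×-dec Edge? G v w) v (S₁-Leaves-neighbour v∈S₁)

    neighbourIn : Subset n → Fin n → Fin n
    neighbourIn I w = find (λ u → u ∈? I ×-dec Edge? G u w) w

    neighbourIn-sound : ∀ {I w} → w ∈ N G I → neighbourIn I w ∈ I × Edge G (neighbourIn I w) w
    neighbourIn-sound {I} {w} w∈N = find-sound (λ u → u ∈? I ×-dec Edge? G u w) w (∈N⁻ G I w∈N)

  ∣Leaves∩N[I]∣≡∣I∣ : ∀ {I} → I ⊆ S₁ → ∣ Leaves ∩ N G I ∣ ≡ ∣ I ∣
  ∣Leaves∩N[I]∣≡∣I∣ {I} I⊆S₁ = ≤-antisym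
    (injection⇒∣p∣≤∣q∣ (Leaves ∩ N G I) I (neighbourIn I) (proj₁ ∘ sound′) λ x∈ y∈ same →
      let u∈I , ux = sound′ x∈ ; _ , uy = sound′ y∈ in
      S₁-Leaves-neighbour-unique (I⊆S₁ u∈I) (p∩q⊆p Leaves _ x∈) (p∩q⊆p Leaves _ y∈) ux (subst (λ u → Edge G u _) (sym same) uy))
    (injection⇒∣p∣≤∣q∣ I (Leaves ∩ N G I) leafOf
      (λ x∈I → let w∈ , e = leafOf-sound (I⊆S₁ x∈I) in x∈p∩q⁺ (w∈ , ∈N⁺ G x∈I e))
      λ x∈ y∈ same → let w∈ , ex = leafOf-sound (I⊆S₁ x∈) ; _ , ey = leafOf-sound (I⊆S₁ y∈) in
        Leaves-neighbour-unique w∈ (Edge-sym G ex) (Edge-sym G (subst (Edge G _) (sym same) ey)))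
    where
    sound′ : ∀ {w} → w ∈ Leaves ∩ N G I → neighbourIn I w ∈ I × Edge G (neighbourIn I w) w
    sound′ = neighbourIn-sound ∘ p∩q⊆q Leaves (N G I)

  ∣Leaves∣≡∣I∣+∣Leaves∩∁N[I]∣ : ∀ {I} → I ⊆ S₁ → ∣ Leaves ∣ ≡ ∣ I ∣ + ∣ Leaves ∩ ∁ (N G I) ∣
  ∣Leaves∣≡∣I∣+∣Leaves∩∁N[I]∣ {I} I⊆S₁ =
    trans (∣p∣≡∣p∩q∣+∣p∩∁q∣ Leaves (N G I)) (cong (_+ ∣ Leaves ∩ ∁ (N G I) ∣) (∣Leaves∩N[I]∣≡∣I∣ I⊆S₁))

  extend : ∀ {I J} → I ⊆ S₁ → Independent G I → MaximalIndependentIn G (R I) J →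
           ∃ λ M → MaximalIndependentIn G ⊤ M × ∣ M ∣ ≡ ∣ Leaves ∣ + ∣ J ∣
  extend {I} {J} I⊆S₁ I-ind ((J⊆R , J-ind) , R⊆J∪N) = M , ((⊆⊤ , M-independent) , M-dominating) , ∣M∣≡
    where
    Lr = Leaves ∩ ∁ (N G I)
    M = I ∪ J ∪ Lr

    I⊆M : I ⊆ M
    I⊆M = p⊆p∪q (J ∪ Lr)
    J⊆M : J ⊆ M
    J⊆M = q⊆p∪q I (J ∪ Lr) ∘ p⊆p∪q Lr
    Lr⊆M : Lr ⊆ M
    Lr⊆M = q⊆p∪q I (J ∪ Lr) ∘ q⊆p∪q J Lr

    J⊆S₀ : J ⊆ S₀
    J⊆S₀ = p∩q⊆p S₀ (∁ (N G I)) ∘ J⊆R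
    J∉N : ∀ {x} → x ∈ J → x ∉ N G I
    J∉N = x∈∁p⇒x∉p ∘ p∩q⊆q S₀ (∁ (N G I)) ∘ J⊆R
    Lr⊆Leaves : Lr ⊆ Leaves
    Lr⊆Leaves = p∩q⊆p Leaves (∁ (N G I))
    Lr∉N : ∀ {x} → x ∈ Lr → x ∉ N G I
    Lr∉N = x∈∁p⇒x∉p ∘ p∩q⊆q Leaves (∁ (N G I))

    data Part (x : Fin n) : Set where
      inI  : x ∈ I  → Part x
      inJ  : x ∈ J  → Part x
      inLr : x ∈ Lr → Part x

    part : ∀ {x} → x ∈ M → Part x
    part x∈ with x∈p∪q⁻ I (J ∪ Lr) x∈
    ... | inj₁ x∈I = inI x∈I
    ... | inj₂ x∈J∪Lr = [ inJ , inLr ]′ (x∈p∪q⁻ J Lr x∈J∪Lr)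

    nonadjacent : ∀ {a b} → Part a → Part b → ¬ Edge G a b
    nonadjacent (inI a∈)  (inI b∈)  e = I-ind _ _ a∈ b∈ e
    nonadjacent (inI a∈)  (inJ b∈)  e = J∉N b∈ (∈N⁺ G a∈ e)
    nonadjacent (inI a∈)  (inLr b∈) e = Lr∉N b∈ (∈N⁺ G a∈ e)
    nonadjacent (inJ a∈)  (inI b∈)  e = J∉N a∈ (∈N⁺ G b∈ (Edge-sym G e))
    nonadjacent (inJ a∈)  (inJ b∈)  e = J-ind _ _ a∈ b∈ e
    nonadjacent (inJ a∈)  (inLr b∈) e = Leaves-S₀-nonadjacent (Lr⊆Leaves b∈) (J⊆S₀ a∈) (Edge-sym G e)
    nonadjacent (inLr a∈) (inI b∈)  e = Lr∉N a∈ (∈N⁺ G b∈ (Edge-sym G e))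
    nonadjacent (inLr a∈) (inJ b∈)  e = Leaves-S₀-nonadjacent (Lr⊆Leaves a∈) (J⊆S₀ b∈) e
    nonadjacent (inLr a∈) (inLr b∈) e = Leaves-independent _ _ (Lr⊆Leaves a∈) (Lr⊆Leaves b∈) e

    M-independent : Independent G M
    M-independent a b a∈ b∈ = nonadjacent (part a∈) (part b∈)

    S₁∖I⊆N[M] : ∀ {v} → v ∈ S₁ → v ∉ I → v ∈ N G M
    S₁∖I⊆N[M] v∈S₁ v∉I with S₁-Leaves-neighbour v∈S₁
    ... | w , w∈Leaves , e = ∈N⁺ G (Lr⊆M (x∈p∩q⁺ (w∈Leaves , x∉p⇒x∈∁p w∉N))) (Edge-sym G e)
      where
      w∉N : w ∉ N G I
      w∉N w∈N = let u , u∈I , e′ = ∈N⁻ G I w∈N in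
        v∉I (subst (_∈ I) (Leaves-neighbour-unique w∈Leaves (Edge-sym G e′) (Edge-sym G e)) u∈I)

    M-dominating : ⊤ ⊆ M ∪ N G M
    M-dominating {v} _ with partition v | v ∈? N G I | v ∈? I
    ... | _                 | yes v∈N | _       = ∪N-mono G I⊆M (q⊆p∪q I (N G I) v∈N)
    ... | inj₁ v∈S₀         | no v∉N  | _       = ∪N-mono G J⊆M (R⊆J∪N (x∈p∩q⁺ (v∈S₀ , x∉p⇒x∈∁p v∉N)))
    ... | inj₂ (inj₂ v∈)    | no v∉N  | _       = p⊆p∪q (N G M) (Lr⊆M (x∈p∩q⁺ (v∈ , x∉p⇒x∈∁p v∉N)))
    ... | inj₂ (inj₁ v∈S₁)  | no _    | yes v∈I = p⊆p∪q (N G M) (I⊆M v∈I)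
    ... | inj₂ (inj₁ v∈S₁)  | no _    | no v∉I  = q⊆p∪q M (N G M) (S₁∖I⊆N[M] v∈S₁ v∉I)

    ∣M∣≡ : ∣ M ∣ ≡ ∣ Leaves ∣ + ∣ J ∣
    ∣M∣≡ = begin
      ∣ M ∣                           ≡⟨ disjoint⇒∣p∪q∣≡∣p∣+∣q∣ I (J ∪ Lr) I-disjoint ⟩
      ∣ I ∣ + ∣ (J ∪ Lr) ∣            ≡⟨ cong (∣ I ∣ +_) (disjoint⇒∣p∪q∣≡∣p∣+∣q∣ J Lr J-disjoint) ⟩
      ∣ I ∣ + (∣ J ∣ + ∣ Lr ∣)        ≡⟨ x∙yz≈xz∙y (∣ I ∣) (∣ J ∣) (∣ Lr ∣) ⟩
      (∣ I ∣ + ∣ Lr ∣) + ∣ J ∣        ≡⟨ cong (_+ ∣ J ∣) (∣Leaves∣≡∣I∣+∣Leaves∩∁N[I]∣ I⊆S₁) ⟨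
      ∣ Leaves ∣ + ∣ J ∣              ∎
      where
      open ≡-Reasoning
      I-disjoint : ∀ {x} → x ∈ I → x ∉ J ∪ Lr
      I-disjoint x∈I x∈ = [ S₀-disjoint-S₁ ∘ J⊆S₀ , ∈Leaves⇒∉S₁ ∘ Lr⊆Leaves ]′ (x∈p∪q⁻ J Lr x∈) (I⊆S₁ x∈I)
      J-disjoint : ∀ {x} → x ∈ J → x ∉ Lr
      J-disjoint x∈J x∈Lr = ∈Leaves⇒∉S₀ (Lr⊆Leaves x∈Lr) (J⊆S₀ x∈J)

  ∣M∣≡∣M∩S₀∣+∣M∩S₁∣+∣M∩Leaves∣ : ∀ M → ∣ M ∣ ≡ ∣ M ∩ S₀ ∣ + (∣ M ∩ S₁ ∣ + ∣ M ∩ Leaves ∣)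
  ∣M∣≡∣M∩S₀∣+∣M∩S₁∣+∣M∩Leaves∣ M = begin
    ∣ M ∣
      ≡⟨ ∣p∣≡∣p∩q∣+∣p∩∁q∣ M S₀ ⟩
    ∣ M ∩ S₀ ∣ + ∣ M ∩ ∁ S₀ ∣
      ≡⟨ cong (∣ M ∩ S₀ ∣ +_) (∣p∣≡∣p∩q∣+∣p∩∁q∣ (M ∩ ∁ S₀) S₁) ⟩
    ∣ M ∩ S₀ ∣ + (∣ (M ∩ ∁ S₀) ∩ S₁ ∣ + ∣ (M ∩ ∁ S₀) ∩ ∁ S₁ ∣)
      ≡⟨ cong (λ X → ∣ M ∩ S₀ ∣ + (∣ X ∣ + ∣ (M ∩ ∁ S₀) ∩ ∁ S₁ ∣)) M∩∁S₀∩S₁≡M∩S₁ ⟩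
    ∣ M ∩ S₀ ∣ + (∣ M ∩ S₁ ∣ + ∣ (M ∩ ∁ S₀) ∩ ∁ S₁ ∣)
      ≡⟨ cong (λ X → ∣ M ∩ S₀ ∣ + (∣ M ∩ S₁ ∣ + ∣ X ∣)) (∩-assoc M (∁ S₀) (∁ S₁)) ⟩
    ∣ M ∩ S₀ ∣ + (∣ M ∩ S₁ ∣ + ∣ M ∩ Leaves ∣)
      ∎
    where
    open ≡-Reasoning
    M∩∁S₀∩S₁≡M∩S₁ : (M ∩ ∁ S₀) ∩ S₁ ≡ M ∩ S₁
    M∩∁S₀∩S₁≡M∩S₁ = trans (∩-assoc M (∁ S₀) S₁) (cong (M ∩_)
      (⊆-antisym (p∩q⊆q (∁ S₀) S₁) (λ x∈S₁ → x∈p∩q⁺ (x∉p⇒x∈∁p (λ x∈S₀ → S₀-disjoint-S₁ x∈S₀ x∈S₁) , x∈S₁))))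

  restrict : ∀ {M} → MaximalIndependentIn G ⊤ M →
             Independent G (M ∩ S₁) × MaximalIndependentIn G (R (M ∩ S₁)) (M ∩ S₀) × ∣ M ∣ ≡ ∣ Leaves ∣ + ∣ M ∩ S₀ ∣
  restrict {M} ((_ , M-ind) , ⊤⊆M∪N) = I-ind , ((J⊆R , J-ind) , R⊆J∪N) , ∣M∣≡
    where
    I = M ∩ S₁
    J = M ∩ S₀
    I-ind : Independent G I
    I-ind a b a∈ b∈ = M-ind a b (p∩q⊆p M S₁ a∈) (p∩q⊆p M S₁ b∈)
    J-ind : Independent G J
    J-ind a b a∈ b∈ = M-ind a b (p∩q⊆p M S₀ a∈) (p∩q⊆p M S₀ b∈)
    M∉N[I] : ∀ {x} → x ∈ M → x ∉ N G I
    M∉N[I] x∈M = Independent⇒∉N G M-ind x∈M ∘ N-mono G (p∩q⊆p M S₁)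
    J⊆R : J ⊆ R I
    J⊆R x∈J = let x∈M , x∈S₀ = x∈p∩q⁻ M S₀ x∈J in x∈p∩q⁺ (x∈S₀ , x∉p⇒x∈∁p (M∉N[I] x∈M))
    R⊆J∪N : R I ⊆ J ∪ N G J
    R⊆J∪N {v} v∈R with x∈p∩q⁻ S₀ (∁ (N G I)) v∈R
    ... | v∈S₀ , v∈∁N with x∈p∪q⁻ M (N G M) (⊤⊆M∪N ∈⊤)
    ...   | inj₁ v∈M = p⊆p∪q (N G J) (x∈p∩q⁺ (v∈M , v∈S₀))
    ...   | inj₂ v∈N with ∈N⁻ G M v∈N
    ...     | u , u∈M , e with partition u
    ...       | inj₁ u∈S₀        = q⊆p∪q J (N G J) (∈N⁺ G (x∈p∩q⁺ (u∈M , u∈S₀)) e)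
    ...       | inj₂ (inj₁ u∈S₁) = contradiction (∈N⁺ G (x∈p∩q⁺ (u∈M , u∈S₁)) e) (x∈∁p⇒x∉p v∈∁N)
    ...       | inj₂ (inj₂ u∈)   = contradiction e (Leaves-S₀-nonadjacent u∈ v∈S₀)
    M∩Leaves≡ : M ∩ Leaves ≡ Leaves ∩ ∁ (N G I)
    M∩Leaves≡ = ⊆-antisym
      (λ w∈ → let w∈M , w∈Leaves = x∈p∩q⁻ M Leaves w∈ in x∈p∩q⁺ (w∈Leaves , x∉p⇒x∈∁p (M∉N[I] w∈M)))
      (λ w∈ → let w∈Leaves , w∈∁N = x∈p∩q⁻ Leaves (∁ (N G I)) w∈ in x∈p∩q⁺ (in-M w∈Leaves (x∈∁p⇒x∉p w∈∁N) , w∈Leaves))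
      where
      in-M : ∀ {w} → w ∈ Leaves → w ∉ N G I → w ∈ M
      in-M w∈Leaves w∉N with x∈p∪q⁻ M (N G M) (⊤⊆M∪N ∈⊤)
      ... | inj₁ w∈M = w∈M
      ... | inj₂ w∈N = let u , u∈M , e = ∈N⁻ G M w∈N in
        contradiction (∈N⁺ G (x∈p∩q⁺ (u∈M , Leaves-neighbour∈S₁ w∈Leaves (Edge-sym G e))) e) w∉N
    ∣M∣≡ : ∣ M ∣ ≡ ∣ Leaves ∣ + ∣ J ∣
    ∣M∣≡ = begin
      ∣ M ∣                                          ≡⟨ ∣M∣≡∣M∩S₀∣+∣M∩S₁∣+∣M∩Leaves∣ M ⟩
      ∣ J ∣ + (∣ I ∣ + ∣ M ∩ Leaves ∣)               ≡⟨ cong (λ X → ∣ J ∣ + (∣ I ∣ + ∣ X ∣)) M∩Leaves≡ ⟩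
      ∣ J ∣ + (∣ I ∣ + ∣ Leaves ∩ ∁ (N G I) ∣)       ≡⟨ cong (∣ J ∣ +_) (∣Leaves∣≡∣I∣+∣Leaves∩∁N[I]∣ (p∩q⊆q M S₁)) ⟨
      ∣ J ∣ + ∣ Leaves ∣                             ≡⟨ +-comm (∣ J ∣) (∣ Leaves ∣) ⟩
      ∣ Leaves ∣ + ∣ J ∣                             ∎
      where open ≡-Reasoning

  R-∅ : R ∅ ≡ S₀
  R-∅ = ⊆-antisym (p∩q⊆p S₀ (∁ (N G ∅)))
    (λ x∈S₀ → x∈p∩q⁺ (x∈S₀ , x∉p⇒x∈∁p (λ x∈N → ∉⊥ (proj₁ (proj₂ (∈N⁻ G ∅ x∈N))))))

  ∅-independent : Independent G ∅
  ∅-independent _ _ u∈∅ = contradiction u∈∅ ∉⊥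

  α⊤≡∣Leaves∣+αS₀ : α G ⊤ ≡ ∣ Leaves ∣ + α G S₀
  α⊤≡∣Leaves∣+αS₀ = ≤-antisym α⊤≤ ≤α⊤
    where
    open ≤-Reasoning
    α⊤≤ : α G ⊤ ≤ ∣ Leaves ∣ + α G S₀
    α⊤≤ =
      let M , M-indep , ∣M∣≡α = α-attained G ⊤
          _ , ((_ , J-ind) , _) , ∣M∣≡ = restrict (maximum⇒maximal G M-indep ∣M∣≡α)
      in begin
      α G ⊤                      ≡⟨ trans (sym ∣M∣≡α) ∣M∣≡ ⟩
      ∣ Leaves ∣ + ∣ M ∩ S₀ ∣    ≤⟨ +-monoʳ-≤ ∣ Leaves ∣ (∣X∣≤α G (p∩q⊆q M S₀ , J-ind)) ⟩
      ∣ Leaves ∣ + α G S₀        ∎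
    ≤α⊤ : ∣ Leaves ∣ + α G S₀ ≤ α G ⊤
    ≤α⊤ =
      let J , J-indep , ∣J∣≡α = α-attained G S₀
          J-max = subst (λ S → MaximalIndependentIn G S J) (sym R-∅) (maximum⇒maximal G J-indep ∣J∣≡α)
          M , (M-indep , _) , ∣M∣≡ = extend ⊥⊆ ∅-independent J-max
      in begin
      ∣ Leaves ∣ + α G S₀        ≡⟨ cong (∣ Leaves ∣ +_) ∣J∣≡α ⟨
      ∣ Leaves ∣ + ∣ J ∣         ≡⟨ ∣M∣≡ ⟨
      ∣ M ∣                      ≤⟨ ∣X∣≤α G M-indep ⟩
      α G ⊤                      ∎

  i⊤≤∣Leaves∣+i[R[I]] : ∀ {I} → I ⊆ S₁ → Independent G I → iNum G ⊤ ≤ ∣ Leaves ∣ + iNum G (R I)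
  i⊤≤∣Leaves∣+i[R[I]] {I} I⊆S₁ I-ind =
    let J , J-max , ∣J∣≡i = i-attained G (R I)
        M , M-max , ∣M∣≡ = extend I⊆S₁ I-ind J-max
    in ≤-trans (i≤∣X∣ G M-max) (≤-reflexive (trans ∣M∣≡ (cong (∣ Leaves ∣ +_) ∣J∣≡i)))

  i⊤-attained : ∃ λ I → I ⊆ S₁ × Independent G I ×
                ∃ λ J → MaximalIndependentIn G (R I) J × iNum G ⊤ ≡ ∣ Leaves ∣ + ∣ J ∣
  i⊤-attained =
    let M , M-max , ∣M∣≡i = i-attained G ⊤
        I-ind , J-max , ∣M∣≡ = restrict M-max
    in M ∩ S₁ , p∩q⊆q M S₁ , I-ind , M ∩ S₀ , J-max , trans (sym ∣M∣≡i) ∣M∣≡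

  α⊤≤i⊤+e⇒αS₀≤i[R[I]]+e : ∀ {e I} → α G ⊤ ≤ iNum G ⊤ + e → I ⊆ S₁ → Independent G I →
                           α G S₀ ≤ iNum G (R I) + e
  α⊤≤i⊤+e⇒αS₀≤i[R[I]]+e {e} {I} α⊤≤ I⊆S₁ I-ind = +-cancelˡ-≤ ∣ Leaves ∣ _ _ (begin
    ∣ Leaves ∣ + α G S₀              ≡⟨ α⊤≡∣Leaves∣+αS₀ ⟨
    α G ⊤                            ≤⟨ α⊤≤ ⟩
    iNum G ⊤ + e                     ≤⟨ +-monoˡ-≤ e (i⊤≤∣Leaves∣+i[R[I]] I⊆S₁ I-ind) ⟩
    ∣ Leaves ∣ + iNum G (R I) + e    ≡⟨ +-assoc ∣ Leaves ∣ (iNum G (R I)) e ⟩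
    ∣ Leaves ∣ + (iNum G (R I) + e)  ∎)
    where open ≤-Reasoning

  αS₀≤∣J∣+e⇒α⊤≤i⊤+e : ∀ {e} →
    (∀ {I J} → I ⊆ S₁ → Independent G I → MaximalIndependentIn G (R I) J → α G S₀ ≤ ∣ J ∣ + e) →
    α G ⊤ ≤ iNum G ⊤ + e
  αS₀≤∣J∣+e⇒α⊤≤i⊤+e {e} αS₀≤ =
    let I , I⊆S₁ , I-ind , J , J-max , i⊤≡ = i⊤-attained in begin
    α G ⊤                      ≡⟨ α⊤≡∣Leaves∣+αS₀ ⟩
    ∣ Leaves ∣ + α G S₀        ≤⟨ +-monoʳ-≤ ∣ Leaves ∣ (αS₀≤ I⊆S₁ I-ind J-max) ⟩
    ∣ Leaves ∣ + (∣ J ∣ + e)   ≡⟨ +-assoc ∣ Leaves ∣ ∣ J ∣ e ⟨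
    ∣ Leaves ∣ + ∣ J ∣ + e     ≡⟨ cong (_+ e) i⊤≡ ⟨
    iNum G ⊤ + e               ∎
    where open ≤-Reasoning

  LocalCondition : ℕ → ℕ → Set
  LocalCondition e b = ∀ I → I ⊆ S₁ → Independent G I → ∣ I ∣ ≤ b → α G S₀ ≤ iNum G (R I) + e

  module _ {I J} (I⊆S₁ : I ⊆ S₁) (I-ind : Independent G I) (J-max : MaximalIndependentIn G (R I) J) where

    private
      J⊆R : J ⊆ R I
      J⊆R = proj₁ (proj₁ J-max)

      J⊆S₀ : J ⊆ S₀
      J⊆S₀ = p∩q⊆p S₀ (∁ (N G I)) ∘ J⊆R

    -- N(I) and N(I′) agree on D, so J ∩ D is kept and only G₀ − N(I′) − D gets a new maximal set.
    patch : ∀ {I′ D} → I′ ⊆ I → D ∩ N G I ⊆ N G I′ → ComponentUnion G S₀ D →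
            ∃ λ J′ → MaximalIndependentIn G (R I′) J′ × ∣ J′ ∣ ≤ ∣ J ∩ D ∣ + α G (S₀ ∩ ∁ D)
    patch {I′} {D} I′⊆I D∩N⊆N (D⊆S₀ , D-closed) = extend-by (maximal-exists G (R I′ ∩ ∁ D))
      where
      extend-by : ∃ (MaximalIndependentIn G (R I′ ∩ ∁ D)) →
                  ∃ λ J′ → MaximalIndependentIn G (R I′) J′ × ∣ J′ ∣ ≤ ∣ J ∩ D ∣ + α G (S₀ ∩ ∁ D)
      extend-by (J″ , ((J″⊆ , J″-ind) , J″-dom)) = J′ , ((J′⊆R , J′-ind) , J′-dom) , ∣J′∣≤
        where
        J′ = (J ∩ D) ∪ J″

        J″⊆S₀-D : J″ ⊆ S₀ ∩ ∁ D
        J″⊆S₀-D x∈ = let x∈R , x∈∁D = x∈p∩q⁻ (R I′) (∁ D) (J″⊆ x∈) in x∈p∩q⁺ (p∩q⊆p S₀ _ x∈R , x∈∁D)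

        J′⊆R : J′ ⊆ R I′
        J′⊆R x∈ with x∈p∪q⁻ (J ∩ D) J″ x∈
        ... | inj₁ x∈J∩D = let x∈S₀ , x∈∁N = x∈p∩q⁻ S₀ (∁ (N G I)) (J⊆R (p∩q⊆p J D x∈J∩D)) in
          x∈p∩q⁺ (x∈S₀ , x∉p⇒x∈∁p (x∈∁p⇒x∉p x∈∁N ∘ N-mono G I′⊆I))
        ... | inj₂ x∈J″ = p∩q⊆p (R I′) (∁ D) (J″⊆ x∈J″)

        J∩D-J″-nonadjacent : ∀ {a b} → a ∈ J ∩ D → b ∈ J″ → ¬ Edge G a b
        J∩D-J″-nonadjacent a∈ b∈ e = let b∈S₀ , b∈∁D = x∈p∩q⁻ S₀ (∁ D) (J″⊆S₀-D b∈) in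
          x∈∁p⇒x∉p b∈∁D (D-closed (p∩q⊆q J D a∈) b∈S₀ e)

        J′-ind : Independent G J′
        J′-ind a b a∈ b∈ e with x∈p∪q⁻ (J ∩ D) J″ a∈ | x∈p∪q⁻ (J ∩ D) J″ b∈
        ... | inj₁ a∈J∩D | inj₁ b∈J∩D = proj₂ (proj₁ J-max) a b (p∩q⊆p J D a∈J∩D) (p∩q⊆p J D b∈J∩D) e
        ... | inj₁ a∈J∩D | inj₂ b∈J″  = J∩D-J″-nonadjacent a∈J∩D b∈J″ e
        ... | inj₂ a∈J″  | inj₁ b∈J∩D = J∩D-J″-nonadjacent b∈J∩D a∈J″ (Edge-sym G e)
        ... | inj₂ a∈J″  | inj₂ b∈J″  = J″-ind a b a∈J″ b∈J″ e

        dominated-in-D : ∀ {v} → v ∈ D → v ∈ J ∪ N G J → v ∈ (J ∩ D) ∪ N G (J ∩ D)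
        dominated-in-D {v} v∈D v∈ with x∈p∪q⁻ J (N G J) v∈
        ... | inj₁ v∈J = p⊆p∪q (N G (J ∩ D)) (x∈p∩q⁺ (v∈J , v∈D))
        ... | inj₂ v∈N = let u , u∈J , e = ∈N⁻ G J v∈N in
          q⊆p∪q (J ∩ D) (N G (J ∩ D)) (∈N⁺ G (x∈p∩q⁺ (u∈J , D-closed v∈D (J⊆S₀ u∈J) (Edge-sym G e))) e)

        J′-dom : R I′ ⊆ J′ ∪ N G J′
        J′-dom {v} v∈R with v ∈? D
        ... | no v∉D = ∪N-mono G (q⊆p∪q (J ∩ D) J″) (J″-dom (x∈p∩q⁺ (v∈R , x∉p⇒x∈∁p v∉D)))
        ... | yes v∈D = let v∈S₀ , v∈∁N′ = x∈p∩q⁻ S₀ (∁ (N G I′)) v∈R in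
          ∪N-mono G (p⊆p∪q J″) (dominated-in-D v∈D (proj₂ J-max (x∈p∩q⁺ (v∈S₀ ,
            x∉p⇒x∈∁p (x∈∁p⇒x∉p v∈∁N′ ∘ D∩N⊆N ∘ λ v∈N → x∈p∩q⁺ (v∈D , v∈N))))))

        ∣J′∣≤ : ∣ J′ ∣ ≤ ∣ J ∩ D ∣ + α G (S₀ ∩ ∁ D)
        ∣J′∣≤ = ≤-trans (∣p∪q∣≤∣p∣+∣q∣ (J ∩ D) J″) (+-monoʳ-≤ ∣ J ∩ D ∣ (∣X∣≤α G (J″⊆S₀-D , J″-ind)))

    N[I]∩D-covered-by-≤∣D∣ : ∀ D → ∃ λ I′ → I′ ⊆ I × D ∩ N G I ⊆ N G I′ × ∣ I′ ∣ ≤ ∣ D ∣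
    N[I]∩D-covered-by-≤∣D∣ D = I′ , I′⊆I , D∩N⊆N[I′] , ≤-trans (∣image∣≤∣p∣ {f = neighbourIn I} {p = D ∩ N G I}) (∣p∩q∣≤∣p∣ D (N G I))
      where
      I′ = image (neighbourIn I) (D ∩ N G I)
      I′⊆I : I′ ⊆ I
      I′⊆I u∈ = let c , c∈ , c↦u = ∈image⁻ u∈ in
        subst (_∈ I) c↦u (proj₁ (neighbourIn-sound (p∩q⊆q D (N G I) c∈)))
      D∩N⊆N[I′] : D ∩ N G I ⊆ N G I′
      D∩N⊆N[I′] c∈ = ∈N⁺ G (∈image⁺ c∈) (proj₂ (neighbourIn-sound (p∩q⊆q D (N G I) c∈)))

    local-bound : ∀ {e b} →
      LocalCondition e b →
      ∀ {D} → ComponentUnion G S₀ D → ∣ D ∣ ≤ b → α G D ≤ ∣ J ∩ D ∣ + e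
    local-bound {e} {b} H {D} D-union ∣D∣≤b =
      let I′ , I′⊆I , D∩N⊆N[I′] , ∣I′∣≤∣D∣ = N[I]∩D-covered-by-≤∣D∣ D
          J′ , J′-max , ∣J′∣≤ = patch I′⊆I D∩N⊆N[I′] D-union
      in +-cancelʳ-≤ (α G (S₀ ∩ ∁ D)) (α G D) (∣ J ∩ D ∣ + e) (begin
      α G D + α G (S₀ ∩ ∁ D)              ≡⟨ α-ComponentUnion-split G S₀ (ComponentUnion-S G S₀) D-union (proj₁ D-union) ⟨
      α G S₀                              ≤⟨ H I′ (I⊆S₁ ∘ I′⊆I) (λ a b a∈ b∈ → I-ind a b (I′⊆I a∈) (I′⊆I b∈)) (≤-trans ∣I′∣≤∣D∣ ∣D∣≤b) ⟩
      iNum G (R I′) + e                   ≤⟨ +-monoˡ-≤ e (≤-trans (i≤∣X∣ G J′-max) ∣J′∣≤) ⟩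
      ∣ J ∩ D ∣ + α G (S₀ ∩ ∁ D) + e      ≡⟨ xy∙z≈xz∙y ∣ J ∩ D ∣ (α G (S₀ ∩ ∁ D)) e ⟩
      ∣ J ∩ D ∣ + e + α G (S₀ ∩ ∁ D)      ∎)
      where open ≤-Reasoning

    private
      C : Fin n → Subset n
      C = component G S₀

      J∩S₀≡J : J ∩ S₀ ≡ J
      J∩S₀≡J = ⊆-antisym (p∩q⊆p J S₀) (λ x∈J → x∈p∩q⁺ (x∈J , J⊆S₀ x∈J))

    αS₀≤∣J∣ : ∀ {n₀} → (∀ {v} → v ∈ S₀ → ∣ C v ∣ ≤ n₀) →
      LocalCondition 0 n₀ →
      α G S₀ ≤ ∣ J ∣
    αS₀≤∣J∣ small H = subst (α G S₀ ≤_) (cong ∣_∣ J∩S₀≡J)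
      (α≤∣J∩T∣-by-components G S₀ J (ComponentUnion-S G S₀) λ v∈S₀ →
        ≤-trans (local-bound H (component-ComponentUnion G S₀ v∈S₀) (small v∈S₀)) (≤-reflexive (+-identityʳ _)))

    Deficient : Subset n → Set
    Deficient D = ∣ J ∩ D ∣ < α G D

    no-two-deficient : ∀ {b B D} →
      LocalCondition 1 b →
      ComponentUnion G S₀ B → ComponentUnion G S₀ D → (∀ {x} → x ∈ B → x ∉ D) → ∣ B ∪ D ∣ ≤ b →
      Deficient B → ¬ Deficient D
    no-two-deficient {B = B} {D} H B-union D-union disjoint ∣B∪D∣≤b B-deficient D-deficient =
      1+n≰n (+-cancelˡ-≤ (∣ J ∩ B ∣ + ∣ J ∩ D ∣) 2 1 (begin
        ∣ J ∩ B ∣ + ∣ J ∩ D ∣ + 2          ≡⟨ trans (+-comm (∣ J ∩ B ∣ + ∣ J ∩ D ∣) 2) (cong suc (sym (+-suc (∣ J ∩ B ∣) (∣ J ∩ D ∣)))) ⟩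
        suc ∣ J ∩ B ∣ + suc ∣ J ∩ D ∣      ≤⟨ +-mono-≤ B-deficient D-deficient ⟩
        α G B + α G D                      ≡⟨ α-disjoint-∪ G S₀ B-union D-union disjoint ⟨
        α G (B ∪ D)                        ≤⟨ local-bound H (ComponentUnion-∪ G S₀ B-union D-union) ∣B∪D∣≤b ⟩
        ∣ J ∩ (B ∪ D) ∣ + 1                ≡⟨ cong (_+ 1) ∣J∩[B∪D]∣≡ ⟩
        ∣ J ∩ B ∣ + ∣ J ∩ D ∣ + 1          ∎))
      where
      open ≤-Reasoning
      ∣J∩[B∪D]∣≡ : ∣ J ∩ (B ∪ D) ∣ ≡ ∣ J ∩ B ∣ + ∣ J ∩ D ∣
      ∣J∩[B∪D]∣≡ = trans (q⊆r⇒∣p∩r∣≡∣p∩q∣+∣p∩r∩∁q∣ J (p⊆p∪q D))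
                         (cong (λ X → ∣ J ∩ B ∣ + ∣ J ∩ X ∣) (disjoint⇒[p∪q]∩∁p≡q B D disjoint))

    αS₀≤∣J∣+1 : ∀ {n₀} → (∀ {v} → v ∈ S₀ → ∣ C v ∣ ≤ n₀) →
      LocalCondition 1 (2 * n₀) →
      α G S₀ ≤ ∣ J ∣ + 1
    αS₀≤∣J∣+1 {n₀} small H = by-cases (any? (λ v → v ∈? S₀ ×-dec ∣ J ∩ C v ∣ <? α G (C v)))
      where
      by-cases : Dec (∃ λ v → v ∈ S₀ × Deficient (C v)) → α G S₀ ≤ ∣ J ∣ + 1
      by-cases (no none-deficient) = ≤-trans
        (subst (α G S₀ ≤_) (cong ∣_∣ J∩S₀≡J) (α≤∣J∩T∣-by-components G S₀ J (ComponentUnion-S G S₀)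
          λ {v} v∈S₀ → ≮⇒≥ (λ deficient → none-deficient (v , v∈S₀ , deficient))))
        (m≤m+n _ 1)
      by-cases (yes (v , v∈S₀ , B-deficient)) = begin
        α G S₀                                ≡⟨ α-ComponentUnion-split G S₀ (ComponentUnion-S G S₀) B-union (proj₁ B-union) ⟩
        α G B + α G (S₀ ∩ ∁ B)                ≤⟨ +-mono-≤ (local-bound H B-union (≤-trans (small v∈S₀) (m≤m+n n₀ _))) rest-good ⟩
        ∣ J ∩ B ∣ + 1 + ∣ J ∩ S₀ ∩ ∁ B ∣      ≡⟨ xy∙z≈xz∙y (∣ J ∩ B ∣) 1 (∣ J ∩ S₀ ∩ ∁ B ∣) ⟩
        ∣ J ∩ B ∣ + ∣ J ∩ S₀ ∩ ∁ B ∣ + 1      ≡⟨ cong (_+ 1) (q⊆r⇒∣p∩r∣≡∣p∩q∣+∣p∩r∩∁q∣ J (proj₁ B-union)) ⟨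
        ∣ J ∩ S₀ ∣ + 1                        ≡⟨ cong (λ X → ∣ X ∣ + 1) J∩S₀≡J ⟩
        ∣ J ∣ + 1                             ∎
        where
        open ≤-Reasoning
        B = C v
        B-union = component-ComponentUnion G S₀ v∈S₀
        rest-union = ComponentUnion-─ G S₀ (ComponentUnion-S G S₀) B-union
        rest-good : α G (S₀ ∩ ∁ B) ≤ ∣ J ∩ S₀ ∩ ∁ B ∣
        rest-good = α≤∣J∩T∣-by-components G S₀ J rest-union λ {u} u∈ →
          let u∈S₀ = proj₁ rest-union u∈
              Cu⊆S₀-B = component-⊆ G S₀ u∈S₀ rest-union u∈
          in ≮⇒≥ (no-two-deficient H B-union (component-ComponentUnion G S₀ u∈S₀)
               (λ x∈B x∈Cu → x∈∁p⇒x∉p (p∩q⊆q S₀ (∁ B) (Cu⊆S₀-B x∈Cu)) x∈B)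
               (≤-trans (∣p∪q∣≤∣p∣+∣q∣ B (C u)) (+-mono-≤ (small v∈S₀) (≤-trans (small u∈S₀) (≤-reflexive (sym (+-identityʳ n₀))))))
               B-deficient)

  α⊤≤i⊤+e⇔LocalCondition : ∀ e b →
    (LocalCondition e b →
     ∀ {I J} → I ⊆ S₁ → Independent G I → MaximalIndependentIn G (R I) J → α G S₀ ≤ ∣ J ∣ + e) →
    α G ⊤ ≤ iNum G ⊤ + e ⇔ LocalCondition e b
  α⊤≤i⊤+e⇔LocalCondition e b local = mk⇔ global⇒local (αS₀≤∣J∣+e⇒α⊤≤i⊤+e ∘ local)
    where
    global⇒local : α G ⊤ ≤ iNum G ⊤ + e → LocalCondition e b
    global⇒local global _ I⊆S₁ I-ind _ = α⊤≤i⊤+e⇒αS₀≤i[R[I]]+e global I⊆S₁ I-ind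

  LocalCondition⇒α≤i+e : ∀ {e b} → LocalCondition e b →
         α G S₀ ≤ iNum G S₀ + e
  LocalCondition⇒α≤i+e {e} H = subst (λ X → α G S₀ ≤ iNum G X + e) R-∅ (H ∅ ⊥⊆ ∅-independent (≤-trans (≤-reflexive (∣⊥∣≡0 n)) z≤n))

  i[R[I]]≡αS₀⇔αS₀≤i[R[I]]+0 : ∀ I → iNum G (R I) ≡ α G S₀ ⇔ α G S₀ ≤ iNum G (R I) + 0
  i[R[I]]≡αS₀⇔αS₀≤i[R[I]]+0 I = mk⇔
    (λ i≡α → ≤-reflexive (trans (sym i≡α) (sym (+-identityʳ _))))
    (λ α≤i → ≤-antisym (≤-trans (i≤α G (R I)) (α-mono G (p∩q⊆p S₀ (∁ (N G I))))) (≤-trans α≤i (≤-reflexive (+-identityʳ _))))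

  module _ {n₀} (small : ∀ {v} → v ∈ S₀ → ∣ component G S₀ v ∣ ≤ n₀) where

    -- The condition on S₀ alone is the instance I = ∅ of the condition on all I.
    WellCovered⇔ : WellCovered G ⊤ ⇔
      (WellCovered G S₀ × (∀ I → I ⊆ S₁ → Independent G I → ∣ I ∣ ≤ n₀ → iNum G (R I) ≡ α G S₀))
    WellCovered⇔ = mk⇔ forward backward
      where
      char : α G ⊤ ≤ iNum G ⊤ + 0 ⇔ LocalCondition 0 n₀
      char = α⊤≤i⊤+e⇔LocalCondition 0 n₀ λ H I⊆S₁ I-ind J-max →
        ≤-trans (αS₀≤∣J∣ I⊆S₁ I-ind J-max small H) (≤-reflexive (sym (+-identityʳ _)))
      forward : WellCovered G ⊤ →
        WellCovered G S₀ × (∀ I → I ⊆ S₁ → Independent G I → ∣ I ∣ ≤ n₀ → iNum G (R I) ≡ α G S₀)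
      forward wc = from (WellCovered⇔α≤i+0 G S₀) (LocalCondition⇒α≤i+e H) ,
                   λ I I⊆S₁ I-ind ∣I∣≤ → from (i[R[I]]≡αS₀⇔αS₀≤i[R[I]]+0 I) (H I I⊆S₁ I-ind ∣I∣≤)
        where H = to char (to (WellCovered⇔α≤i+0 G ⊤) wc)
      backward : WellCovered G S₀ × (∀ I → I ⊆ S₁ → Independent G I → ∣ I ∣ ≤ n₀ → iNum G (R I) ≡ α G S₀) →
        WellCovered G ⊤
      backward (_ , conditions) = from (WellCovered⇔α≤i+0 G ⊤) (from char λ I I⊆S₁ I-ind ∣I∣≤ →
        to (i[R[I]]≡αS₀⇔αS₀≤i[R[I]]+0 I) (conditions I I⊆S₁ I-ind ∣I∣≤))

    μα≤1⇔ : μα G ⊤ ≤ 1 ⇔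
      ((μα G S₀ ≤ 1) × (∀ I → I ⊆ S₁ → Independent G I → ∣ I ∣ ≤ 2 * n₀ → α G S₀ ∸ iNum G (R I) ≤ 1))
    μα≤1⇔ = mk⇔ forward backward
      where
      char : α G ⊤ ≤ iNum G ⊤ + 1 ⇔ LocalCondition 1 (2 * n₀)
      char = α⊤≤i⊤+e⇔LocalCondition 1 (2 * n₀) λ H I⊆S₁ I-ind J-max → αS₀≤∣J∣+1 I⊆S₁ I-ind J-max small H
      forward : μα G ⊤ ≤ 1 →
        (μα G S₀ ≤ 1) × (∀ I → I ⊆ S₁ → Independent G I → ∣ I ∣ ≤ 2 * n₀ → α G S₀ ∸ iNum G (R I) ≤ 1)
      forward μα≤1 = from (μα≤e⇔α≤i+e G S₀) (LocalCondition⇒α≤i+e H) ,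
                     λ I I⊆S₁ I-ind ∣I∣≤ → from m∸n≤o⇔m≤n+o (H I I⊆S₁ I-ind ∣I∣≤)
        where H = to char (to (μα≤e⇔α≤i+e G ⊤) μα≤1)
      backward : (μα G S₀ ≤ 1) × (∀ I → I ⊆ S₁ → Independent G I → ∣ I ∣ ≤ 2 * n₀ → α G S₀ ∸ iNum G (R I) ≤ 1) →
        μα G ⊤ ≤ 1
      backward (_ , conditions) = from (μα≤e⇔α≤i+e G ⊤) (from char λ I I⊆S₁ I-ind ∣I∣≤ →
        to m∸n≤o⇔m≤n+o (conditions I I⊆S₁ I-ind ∣I∣≤))

corollary2p10 : ∀ {n : ℕ} (G : Graph n) (S₀ S₁ : Subset n) (n₀ : ℕ) →
    (∀ v → Internal G v → HasType G 0 v ⊎ HasType G 1 v) →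
    (∀ v → (v ∈ S₀) ⇔ HasType G 0 v) →
    (∀ v → (v ∈ S₁) ⇔ HasType G 1 v) →
    IsMaxCompSize G S₀ n₀ →
    (WellCovered G ⊤ ⇔
      (WellCovered G S₀ ×
       (∀ I → I ⊆ S₁ → Independent G I → ∣ I ∣ ≤ n₀ →
          iNum G (S₀ ∩ ∁ (N G I)) ≡ α G S₀)))
    ×
    ((μα G ⊤ ≤ 1) ⇔
      ((μα G S₀ ≤ 1) ×
       (∀ I → I ⊆ S₁ → Independent G I → ∣ I ∣ ≤ 2 * n₀ →
          α G S₀ ∸ iNum G (S₀ ∩ ∁ (N G I)) ≤ 1)))
corollary2p10 G S₀ S₁ n₀ internal-type S₀⇔type0 S₁⇔type1 (components-≤n₀ , _) =
  WellCovered⇔ small , μα≤1⇔ small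
  where
  open TypesZeroAndOne G S₀ S₁ internal-type S₀⇔type0 S₁⇔type1
  small : ∀ {v} → v ∈ S₀ → ∣ component G S₀ v ∣ ≤ n₀
  small v∈S₀ = components-≤n₀ _ _ v∈S₀ (component-CompSize G S₀ v∈S₀)
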